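{- Let $\mathrm{Bool}_{\mathrm{t}}$ be a set subspecies of $\mathrm{Bool}$ such that $1\in\mathrm{Bool}_{\mathrm{t}}(\emptyset)$, $f\star_1 g\in\mathrm{Bool}_{\mathrm{t}}(X\sqcup Y)$ whenever $X,Y$ are disjoint, $f\in\mathrm{Bool}_{\mathrm{t}}(X)$, $g\in\mathrm{Bool}_{\mathrm{t}}(Y)$, and $f_{\mid Y}\in\mathrm{Bool}_{\mathrm{t}}(Y)$ whenever $Y\subseteq X$ and $f\in\mathrm{Bool}_{\mathrm{t}}(X)$. Let $\mathcal{E}$ assign to each $f\in\mathrm{Bool}_{\mathrm{t}}(X)$ a set $\mathcal{E}(f)$ of equivalences on $X$, compatible with bijections (if $\sigma:X\to Y$ is a bijection, $\mathcal{E}(f\circ\sigma^{ -1})=\{\sim_\sigma:\sim\in\mathcal{E}(f)\}$ where $x'\sim_\sigma y'\iff\sigma^{ -1}(x')\sim\sigma^{ -1}(y')$), and such that $f/{\sim}\in\mathrm{Bool}_{\mathrm{t}}(X/{\sim})$ for all $\sim\in\mathcal{E}(f)$. Assume that $\mathcal{E}$ satisfies the $\star_1$, $\delta$, $\Delta$ and $\epsilon$ conditions on $\mathrm{Bool}_{\mathrm{t}}$. Then for every finite set $X$ and every $f\in\mathrm{Bool}_{\mathrm{t}}(X)$, $\mathcal{E}(f)=\mathcal{E}^S(f)=\mathcal{E}^W(f)$.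
   Context: A boolean function on a finite set $X$ is a map $f:\mathcal{P}(X)\to\mathbb{Z}$ with $f(\emptyset)=0$; $\mathrm{Bool}(X)$ is the set of them; $1$ is the unique element of $\mathrm{Bool}(\emptyset)$. A set subspecies assigns to each $X$ a subset $\mathrm{Bool}_{\mathrm{t}}(X)\subseteq\mathrm{Bool}(X)$ stable under relabelling by bijections $f\mapsto f\circ\sigma^{ -1}$. $f_{\mid Y}$ is restriction to $\mathcal{P}(Y)$; $f\star_1 g(A)=f(A\cap X)+g(A\cap Y)$ for disjoint $X,Y$. For nonempty $X$, $f$ is indecomposable if $f=f'\star_1f''$ with $f'\in\mathrm{Bool}(X\setminus Y)$, $f''\in\mathrm{Bool}(Y)$ forces $Y\in\{\emptyset,X\}$. $\sim_f^i$ is the unique equivalence on $X$ such that $f$ is the $\star_1$-product of the $f_{\mid Y}$ over its classes and each such $f_{\mid Y}$ is indecomposable; $\mathrm{ic}(f)$ is its number of classes ($\mathrm{ic}(1)=0$). $f$ is modular if $f(A)=\sum_{x\in A}f(\{x\})$ for all $A$. For an equivalence $\sim$ on $X$ ($\varpi_\sim$ the projection, $\mathrm{cl}(\sim)$ the number of classes): $f/{\sim}(A)=f(\varpi_\sim^{ -1}(A))$, $f\mid\sim(A)=\sum_{Y\in X/\sim}f(A\cap Y)$; for $\sim\subseteq\sim'$, $\overline{\sim'}$ is the induced equivalence on $X/{\sim}$. $\mathcal{E}^W(f)=\{\sim:\mathrm{ic}(f\mid\sim)=\mathrm{cl}(\sim)\}$ and $\mathcal{E}^S(f)=\{\sim\in\mathcal{E}^W(f):\mathrm{ic}(f/{\sim})=\mathrm{ic}(f)\}$.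 Conditions on $\mathcal{E}$ (all $f,g$ ranging in $\mathrm{Bool}_{\mathrm{t}}$): - $\star_1$: the unique equivalence on $\emptyset$ lies in $\mathcal{E}(1)$, and $\mathcal{E}(f\star_1 g)=\{\sim_X\sqcup\sim_Y:\sim_X\in\mathcal{E}(f),\sim_Y\in\mathcal{E}(g)\}$. - $\delta$: for equivalences $\sim\subseteq\sim'$ on $X$: ($\sim\in\mathcal{E}(f)$ and $\overline{\sim'}\in\mathcal{E}(f/{\sim})$) iff ($\sim'\in\mathcal{E}(f)$ and $\sim\in\mathcal{E}(f\mid\sim')$). - $\Delta$: for disjoint $X,Y$, $f\in\mathrm{Bool}_{\mathrm{t}}(X\sqcup Y)$, $\sim_X,\sim_Y$ equivalences on $X,Y$: $\sim_X\sqcup\sim_Y\in\mathcal{E}(f)$ iff $\sim_X\in\mathcal{E}(f_{\mid X})$ and $\sim_Y\in\mathcal{E}(f_{\mid Y})$. - $\epsilon$: $\sim_f^i$ and $=_X$ lie in $\mathcal{E}(f)$; for $\sim\in\mathcal{E}(f)$, $f\mid\sim$ is modular iff $\sim$ is $=_X$; for $\sim\in\mathcal{E}(f)$, $f/{\sim}$ is modular iff $\sim=\sim_f^i$. -}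

module Defs where

-- Finite sets are modelled as Fin n (every finite set is in bijection with one,
-- and all data below are required to be stable under relabelling).
-- Subsets of Fin n are Data.Fin.Subset (Vec Bool n), so ≡ on subsets is extensional.

open import Data.Nat using (ℕ; zero; suc; _<ᵇ_)
open import Data.Fin using (Fin; zero; suc; toℕ; _≟_)
open import Data.Fin.Subset using (Subset; _∩_; _─_; ⊥; ⊤; ⁅_⁆; _⊆_; Nonempty)
open import Data.Fin.Permutation using (Permutation′; _⟨$⟩ʳ_)
open import Data.Vec using (tabulate; lookup)
open import Data.Bool using (Bool; true; false; _∧_; _∨_; not; if_then_else_)
open import Data.Integer using (ℤ; _+_; 0ℤ)
open import Data.Product using (Σ; ∃; _×_; _,_)
open import Data.Sum using (_⊎_)
open import Function.Bundles using (_⇔_)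
open import Relation.Nullary using (¬_)
open import Relation.Nullary.Decidable using (⌊_⌋)
open import Relation.Binary.PropositionalEquality using (_≡_)

sumZ : {n : ℕ} → (Fin n → ℤ) → ℤ
sumZ {zero}  f = 0ℤ
sumZ {suc n} f = f zero + sumZ (λ i → f (suc i))

anyF : {n : ℕ} → (Fin n → Bool) → Bool
anyF {zero}  p = false
anyF {suc n} p = p zero ∨ anyF (λ i → p (suc i))

countF : {n : ℕ} → (Fin n → Bool) → ℕ
countF {zero}  p = zero
countF {suc n} p = if p zero then suc (countF (λ i → p (suc i)))
                             else countF (λ i → p (suc i))

-- Set functions P(Fin n) → ℤ.  Bool(X) is the subset with f(∅) = 0;
-- here the ambient type is all functions and f(∅)=0 is imposed where needed.

BFun : ℕ → Set
BFun n = Subset n → ℤ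

one : BFun 0
one _ = 0ℤ

_≈F_ : {n : ℕ} → BFun n → BFun n → Set
f ≈F g = ∀ A → f A ≡ g A

preimage : {n k : ℕ} → (Fin n → Fin k) → Subset k → Subset n
preimage π A = tabulate (λ x → lookup A (π x))

image : {m n : ℕ} → (Fin m → Fin n) → Subset m → Subset n
image ι B = tabulate (λ x → anyF (λ y → ⌊ ι y ≟ x ⌋ ∧ lookup B y))

Injective : {m n : ℕ} → (Fin m → Fin n) → Set
Injective ι = ∀ x y → ι x ≡ ι y → x ≡ y

Surjective : {m n : ℕ} → (Fin m → Fin n) → Set
Surjective π = ∀ a → ∃ λ x → π x ≡ a

-- f ∘ σ⁻¹ for a permutation σ : (f ∘ σ⁻¹)(A) = f(σ⁻¹(A))
relabel : {n : ℕ} → Permutation′ n → BFun n → BFun n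
relabel σ f A = f (preimage (σ ⟨$⟩ʳ_) A)

-- restriction f_{|Y}, where Y ⊆ X is given by an injection ι : Fin m → Fin n
restrict : {m n : ℕ} → (Fin m → Fin n) → BFun n → BFun m
restrict ι f B = f (image ι B)

Split : {a b n : ℕ} → (Fin a → Fin n) → (Fin b → Fin n) → Set
Split ι₁ ι₂ = Injective ι₁ × Injective ι₂ × (∀ x y → ¬ (ι₁ x ≡ ι₂ y))
            × (∀ z → (∃ λ x → ι₁ x ≡ z) ⊎ (∃ λ y → ι₂ y ≡ z))

-- f ⋆₁ g on X ⊔ Y (w.r.t. a Split ι₁ ι₂) : A ↦ f(A ∩ X) + g(A ∩ Y)
star : {a b n : ℕ} → (Fin a → Fin n) → (Fin b → Fin n) → BFun a → BFun b → BFun n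
star ι₁ ι₂ f g A = f (preimage ι₁ A) + g (preimage ι₂ A)

Rel : ℕ → Set
Rel n = Fin n → Fin n → Bool

IsEquiv : {n : ℕ} → Rel n → Set
IsEquiv R = (∀ x → R x x ≡ true)
          × (∀ x y → R x y ≡ true → R y x ≡ true)
          × (∀ x y z → R x y ≡ true → R y z ≡ true → R x z ≡ true)

_≈R_ : {n : ℕ} → Rel n → Rel n → Set
R ≈R R' = ∀ x y → R x y ≡ R' x y

_⊆R_ : {n : ℕ} → Rel n → Rel n → Set
R ⊆R R' = ∀ x y → R x y ≡ true → R' x y ≡ true

idRel : {n : ℕ} → Rel n
idRel x y = ⌊ x ≟ y ⌋

emptyRel : Rel 0
emptyRel ()

IsDiscrete : {n : ℕ} → Rel n → Set
IsDiscrete R = ∀ x y → R x y ≡ true → x ≡ y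

pullRel : {m n : ℕ} → (Fin m → Fin n) → Rel n → Rel m
pullRel ι R x y = R (ι x) (ι y)

NoCross : {a b n : ℕ} → (Fin a → Fin n) → (Fin b → Fin n) → Rel n → Set
NoCross ι₁ ι₂ R = ∀ x y → (R (ι₁ x) (ι₂ y) ≡ false) × (R (ι₂ y) (ι₁ x) ≡ false)

class : {n : ℕ} → Rel n → Fin n → Subset n
class R x = tabulate (R x)

-- x is the least element of its class (one representative per class)
isMin : {n : ℕ} → Rel n → Fin n → Bool
isMin R x = not (anyF (λ y → (toℕ y <ᵇ toℕ x) ∧ R y x))

cl : {n : ℕ} → Rel n → ℕ
cl R = countF (isMin R)

restrictSum : {n : ℕ} → BFun n → Rel n → BFun n
restrictSum f R A = sumZ (λ x → if isMin R x then f (A ∩ class R x) else 0ℤ)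

-- quotients: π : Fin n → Fin k is a presentation of X/∼ with projection ϖ_∼ = π
QuotRep : {n k : ℕ} → Rel n → (Fin n → Fin k) → Set
QuotRep R π = Surjective π × (∀ x y → (π x ≡ π y) ⇔ (R x y ≡ true))

quot : {n k : ℕ} → (Fin n → Fin k) → BFun n → BFun k
quot π f A = f (preimage π A)

barRel : {n k : ℕ} → (Fin n → Fin k) → Rel n → Rel k
barRel π R' a b = anyF (λ x → anyF (λ y → ⌊ π x ≟ a ⌋ ∧ ⌊ π y ≟ b ⌋ ∧ R' x y))

Modular : {n : ℕ} → BFun n → Set
Modular f = ∀ A → f A ≡ sumZ (λ x → if lookup A x then f ⁅ x ⁆ else 0ℤ)

-- f_{|C} (a function on P(C), C ⊆ X) is indecomposable:
-- C nonempty, and f_{|C} = f' ⋆₁ f'' with f' ∈ Bool(C ∖ Z), f'' ∈ Bool(Z) forces Z ∈ {∅, C}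
IndecOn : {n : ℕ} → BFun n → Subset n → Set
IndecOn f C = Nonempty C
  × (∀ Z → Z ⊆ C
     → (Σ (BFun _) λ g → Σ (BFun _) λ h → (g ⊥ ≡ 0ℤ) × (h ⊥ ≡ 0ℤ)
          × (∀ A → A ⊆ C → f A ≡ g (A ∩ (C ─ Z)) + h (A ∩ Z)))
     → (Z ≡ ⊥) ⊎ (Z ≡ C))

Indecomposable : {n : ℕ} → BFun n → Set
Indecomposable f = IndecOn f ⊤

IsIcDecomp : {n : ℕ} → BFun n → Rel n → Set
IsIcDecomp f R = (∀ A → f A ≡ restrictSum f R A) × (∀ x → IndecOn f (class R x))

-- ic(f) ≡ k  (∼_f^i is unique, so this is a functional relation)
Ic : {n : ℕ} → BFun n → ℕ → Set
Ic f k = Σ (Rel _) λ R → IsEquiv R × IsIcDecomp f R × (cl R ≡ k)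

EW : {n : ℕ} → BFun n → Rel n → Set
EW f R = Ic (restrictSum f R) (cl R)

-- E^S(f) : additionally ic(f/∼) = ic(f)  (for the presentation(s) of X/∼)
ES : {n : ℕ} → BFun n → Rel n → Set
ES f R = EW f R × (∀ k (π : Fin _ → Fin k) → QuotRep R π
                    → ∃ λ m → Ic f m × Ic (quot π f) m)

record Hyps (T : (n : ℕ) → BFun n → Set)
            (E : (n : ℕ) → BFun n → Rel n → Set) : Set where
  field
    -- Bool_t is a set subspecies of Bool (functions are taken extensionally)
    T-ext     : ∀ {n} {f g : BFun n} → f ≈F g → T n f → T n g
    T-empty   : ∀ {n} {f : BFun n} → T n f → f ⊥ ≡ 0ℤ
    T-relabel : ∀ {n} (σ : Permutation′ n) {f : BFun n} → T n f → T n (relabel σ f)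
    T-one     : T 0 one
    T-star    : ∀ {a b n} (ι₁ : Fin a → Fin n) (ι₂ : Fin b → Fin n) → Split ι₁ ι₂
                → ∀ {f g} → T a f → T b g → T n (star ι₁ ι₂ f g)
    T-restrict : ∀ {m n} (ι : Fin m → Fin n) → Injective ι
                → ∀ {f} → T n f → T m (restrict ι f)
    E-equiv   : ∀ {n f R} → T n f → E n f R → IsEquiv R
    E-ext     : ∀ {n} {f g : BFun n} {R R' : Rel n} → f ≈F g → R ≈R R'
                → T n f → E n f R → E n g R'
    E-relabel : ∀ {n} (σ : Permutation′ n) {f : BFun n} → T n f → (R : Rel n)
                → E n (relabel σ f) R ⇔ E n f (pullRel (σ ⟨$⟩ʳ_) R)
    T-quot    : ∀ {n k f R} (π : Fin n → Fin k) → T n f → E n f R → QuotRep R π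
                → T k (quot π f)
    E-one     : E 0 one emptyRel
    E-star    : ∀ {a b n} (ι₁ : Fin a → Fin n) (ι₂ : Fin b → Fin n) → Split ι₁ ι₂
                → ∀ {f g} → T a f → T b g → (R : Rel n)
                → E n (star ι₁ ι₂ f g) R
                  ⇔ (NoCross ι₁ ι₂ R × E a f (pullRel ι₁ R) × E b g (pullRel ι₂ R))
    E-δ       : ∀ {n k f} → T n f → (R R' : Rel n) → IsEquiv R → IsEquiv R' → R ⊆R R'
                → (π : Fin n → Fin k) → QuotRep R π
                → (E n f R × E k (quot π f) (barRel π R'))
                  ⇔ (E n f R' × E n (restrictSum f R') R)
    E-Δ       : ∀ {a b n} (ι₁ : Fin a → Fin n) (ι₂ : Fin b → Fin n) → Split ι₁ ι₂
                → ∀ {f} → T n f → (R : Rel n) → IsEquiv R → NoCross ι₁ ι₂ R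
                → E n f R ⇔ (E a (restrict ι₁ f) (pullRel ι₁ R)
                             × E b (restrict ι₂ f) (pullRel ι₂ R))
    E-ε-ic    : ∀ {n f} → T n f → (R : Rel n) → IsEquiv R → IsIcDecomp f R → E n f R
    E-ε-id    : ∀ {n f} → T n f → E n f idRel
    E-ε-mod   : ∀ {n f} → T n f → (R : Rel n) → E n f R
                → Modular (restrictSum f R) ⇔ IsDiscrete R
    E-ε-quot  : ∀ {n k f} → T n f → (R : Rel n) → E n f R
                → (π : Fin n → Fin k) → QuotRep R π
                → Modular (quot π f) ⇔ IsIcDecomp f R

{-# OPTIONS --safe #-}

-- Both E(f) and E^W(f) turn out to be the set of equivalences all of whose classes are
-- indecomposable for f.  For E, condition Δ cuts a relation into its restriction to one
-- class and the rest.  On a single class the quotient is a point, where every function is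
-- modular, so by ε the restricted relation is the ic decomposition of the restricted
-- function and the class is indecomposable; conversely ε puts a single indecomposable
-- class into E, and Δ glues the classes together.  For E^W, f ∣ ∼ agrees with f on each
-- class, and an ic decomposition of f ∣ ∼ refines ∼ (its classes are indecomposable,
-- while f ∣ ∼ splits along the classes of ∼); having cl(∼) classes, it is ∼ itself.
--
-- The extra condition of E^S holds on E(f): by the same refinement argument ∼ is finer
-- than the ic decomposition ∼ᵢ of f, which exists because a minimal nonempty set along
-- which f splits is indecomposable.  Condition δ moves ∼ᵢ to the induced relation on
-- X/∼, and ε, applied to f and to f/∼, shows that it is the ic decomposition of f/∼,
-- with cl(∼ᵢ) classes.

module Submission where

open import Defs

open import Data.Bool using (Bool; true; false; _∧_; _∨_; not; if_then_else_)
open import Data.Bool.Properties using (∧-conicalˡ; ∧-conicalʳ; ∨-zeroʳ; ∧-identityʳ; not-injective; T-≡; ¬-not)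
open import Data.Fin as Fin using (Fin; zero; suc; toℕ; _≟_)
open import Data.Fin.Induction using (<-wellFounded)
import Data.Fin.Properties as Fin
open import Data.Fin.Subset using (Subset; inside; outside; _∈_; _∉_; _⊆_; _⊂_; _∩_; _─_; ∁; ⊥; ⊤; ⁅_⁆; ∣_∣; Nonempty; Empty)
open import Data.Fin.Subset.Properties using (_∈?_; _⊆?_; _⊂?_; nonempty?; anySubset?; ⊆-refl; ⊆-trans; ⊆-antisym; ⊆⊤; ∈⊤; ∉⊥; Empty-unique; x∈p∩q⁺; x∈p∩q⁻; p∩q⊆p; p∩q⊆q; ∩-zeroˡ; x∈p∧x∉q⇒x∈p─q; p─q⊆p; x∈p⇒x∉∁p; x∈∁p⇒x∉p; x∉p⇒x∈∁p; p⊂q⇒∣p∣<∣q∣; p∩q≢∅⇒∣p─q∣<∣p∣; ∣⊤∣≡n)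
open import Data.Integer using (ℤ; 0ℤ; _+_)
import Data.Integer.Properties as ℤ
open import Algebra.Properties.CommutativeSemigroup ℤ.+-commutativeSemigroup using (interchange)
open import Data.Nat as ℕ using (ℕ; zero; suc; _<ᵇ_)
import Data.Nat.Induction as ℕ
import Data.Nat.Properties as ℕ
open import Data.Product using (Σ; ∃; ∃₂; _×_; _,_; proj₁; proj₂)
open import Data.Sum as Sum using (_⊎_; inj₁; inj₂)
open import Data.Vec using ([]; _∷_; tabulate; lookup; here; there)
open import Data.Vec.Properties using (lookup⇒[]=; []=⇒lookup; lookup∘tabulate; tabulate-cong)
open import Function using (_∘_; id)
open import Function.Bundles using (_⇔_; mk⇔; Equivalence)
open import Induction.WellFounded using (Acc; acc)
open import Relation.Binary.Definitions using (tri<; tri≈; tri>)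
open import Relation.Binary.PropositionalEquality
open import Relation.Nullary using (Dec; yes; no; ¬_; ¬?; contradiction)
open import Relation.Nullary.Decidable using (⌊_⌋; ⌊⌋-map′; _×-dec_; _→-dec_; decidable-stable)

private variable
  n m k : ℕ
  x y z : Fin n
  f g : BFun n
  R S : Rel n
  C K W Z Z₀ : Subset n
  p q A B : Subset n

bool-ext : ∀ {a b : Bool} → (a ≡ true → b ≡ true) → (b ≡ true → a ≡ true) → a ≡ b
bool-ext {true} a⇒b _ = sym (a⇒b refl)
bool-ext {false} {true} _ b⇒a = b⇒a refl
bool-ext {false} {false} _ _ = refl

∨-true⁻ : ∀ a {b} → a ∨ b ≡ true → a ≡ true ⊎ b ≡ true
∨-true⁻ true _ = inj₁ refl
∨-true⁻ false e = inj₂ e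

≟-refl : ∀ (x : Fin n) → ⌊ x ≟ x ⌋ ≡ true
≟-refl x with x ≟ x
... | yes _ = refl
... | no x≢x = contradiction refl x≢x

≟-true⁻ : ⌊ x ≟ y ⌋ ≡ true → x ≡ y
≟-true⁻ {x = x} {y} e with x ≟ y
... | yes x≡y = x≡y
... | no _ with () ← e

≟-false⁻ : ⌊ x ≟ y ⌋ ≡ false → x ≢ y
≟-false⁻ {x = x} e refl with () ← trans (sym (≟-refl x)) e

≟-false⁺ : x ≢ y → ⌊ x ≟ y ⌋ ≡ false
≟-false⁺ {x = x} {y} x≢y with x ≟ y
... | yes x≡y = contradiction x≡y x≢y
... | no _ = refl

⌊suc≟suc⌋ : ⌊ suc x ≟ suc y ⌋ ≡ ⌊ x ≟ y ⌋
⌊suc≟suc⌋ {x = x} {y} = ⌊⌋-map′ (cong suc) Fin.suc-injective (x ≟ y)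

anyF-true⁺ : ∀ (p : Fin n → Bool) x → p x ≡ true → anyF p ≡ true
anyF-true⁺ p zero px rewrite px = refl
anyF-true⁺ p (suc x) px rewrite anyF-true⁺ (p ∘ suc) x px = ∨-zeroʳ (p zero)

anyF-true⁻ : ∀ (p : Fin n → Bool) → anyF p ≡ true → ∃ λ x → p x ≡ true
anyF-true⁻ {zero} p ()
anyF-true⁻ {suc n} p e with ∨-true⁻ (p zero) e
... | inj₁ p0 = zero , p0
... | inj₂ rest = let (x , px) = anyF-true⁻ (p ∘ suc) rest in suc x , px

anyF-cong : ∀ {p q : Fin n → Bool} → (∀ x → p x ≡ q x) → anyF p ≡ anyF q
anyF-cong {zero} _ = refl
anyF-cong {suc n} e = cong₂ _∨_ (e zero) (anyF-cong (e ∘ suc))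

sumZ-cong : ∀ {g h : Fin n → ℤ} → (∀ x → g x ≡ h x) → sumZ g ≡ sumZ h
sumZ-cong {zero} _ = refl
sumZ-cong {suc n} e = cong₂ _+_ (e zero) (sumZ-cong (e ∘ suc))

sumZ-+ : ∀ (g h : Fin n → ℤ) → sumZ (λ x → g x + h x) ≡ sumZ g + sumZ h
sumZ-+ {zero} g h = refl
sumZ-+ {suc n} g h =
  trans (cong (g zero + h zero +_) (sumZ-+ (g ∘ suc) (h ∘ suc))) (interchange (g zero) (h zero) (sumZ (g ∘ suc)) (sumZ (h ∘ suc)))

sumZ-zero : ∀ {g : Fin n → ℤ} → (∀ x → g x ≡ 0ℤ) → sumZ g ≡ 0ℤ
sumZ-zero {zero} _ = refl
sumZ-zero {suc n} z = cong₂ _+_ (z zero) (sumZ-zero (z ∘ suc))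

sumZ-single : ∀ (g : Fin n → ℤ) x₀ → (∀ x → x ≢ x₀ → g x ≡ 0ℤ) → sumZ g ≡ g x₀
sumZ-single g zero others =
  trans (cong (g zero +_) (sumZ-zero λ x → others (suc x) λ ())) (ℤ.+-identityʳ _)
sumZ-single g (suc x₀) others =
  trans (cong (_+ sumZ (g ∘ suc)) (others zero λ ()))
        (trans (ℤ.+-identityˡ _)
               (sumZ-single (g ∘ suc) x₀ λ x x≢x₀ → others (suc x) (x≢x₀ ∘ Fin.suc-injective)))

if-zero : ∀ b {v : ℤ} → v ≡ 0ℤ → (if b then v else 0ℤ) ≡ 0ℤ
if-zero true v≡0 = v≡0
if-zero false _ = refl

if-+ : ∀ b {v v₁ v₂ : ℤ} → v ≡ v₁ + v₂ → (if b then v else 0ℤ) ≡ (if b then v₁ else 0ℤ) + (if b then v₂ else 0ℤ)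
if-+ true e = e
if-+ false _ = refl

countF-cong : ∀ {p q : Fin n → Bool} → (∀ x → p x ≡ q x) → countF p ≡ countF q
countF-cong {zero} _ = refl
countF-cong {suc n} {p} {q} e rewrite e zero | countF-cong {p = p ∘ suc} {q ∘ suc} (e ∘ suc) = refl

countF-true : countF {n} (λ _ → true) ≡ n
countF-true {zero} = refl
countF-true {suc n} = cong suc countF-true

countF-false : ∀ {p : Fin n → Bool} → (∀ x → p x ≡ false) → countF p ≡ 0
countF-false {zero} _ = refl
countF-false {suc n} {p} none rewrite none zero = countF-false (none ∘ suc)

countF-mono : ∀ {p q : Fin n → Bool} → (∀ x → p x ≡ true → q x ≡ true) → countF p ℕ.≤ countF q
countF-mono {zero} _ = ℕ.z≤n
countF-mono {suc n} {p} {q} p⇒q with p zero in p0 | q zero in q0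
... | true | true = ℕ.s≤s (countF-mono (p⇒q ∘ suc))
... | true | false with () ← trans (sym (p⇒q zero p0)) q0
... | false | true = ℕ.m≤n⇒m≤1+n (countF-mono (p⇒q ∘ suc))
... | false | false = countF-mono (p⇒q ∘ suc)

countF-≡⇒⊇ : ∀ {p q : Fin n → Bool} → (∀ x → p x ≡ true → q x ≡ true) → countF p ≡ countF q
           → ∀ x → q x ≡ true → p x ≡ true
countF-≡⇒⊇ {suc n} {p} {q} p⇒q eq x qx with p zero in p0 | q zero in q0
... | true | false with () ← trans (sym (p⇒q zero p0)) q0
... | false | true = contradiction (subst (ℕ._≤ countF (q ∘ suc)) eq (countF-mono (p⇒q ∘ suc))) ℕ.1+n≰n
countF-≡⇒⊇ {suc n} p⇒q eq zero qx | true | true = p0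
countF-≡⇒⊇ {suc n} p⇒q eq (suc x) qx | true | true = countF-≡⇒⊇ (p⇒q ∘ suc) (ℕ.suc-injective eq) x qx
countF-≡⇒⊇ {suc n} p⇒q eq zero qx | false | false with () ← trans (sym qx) q0
countF-≡⇒⊇ {suc n} p⇒q eq (suc x) qx | false | false = countF-≡⇒⊇ (p⇒q ∘ suc) eq x qx

countF-remove : ∀ {q : Fin n → Bool} a → q a ≡ true → countF q ≡ suc (countF (λ y → q y ∧ not ⌊ y ≟ a ⌋))
countF-remove {suc n} {q} zero qa
  rewrite qa = cong suc (countF-cong λ y → sym (∧-identityʳ (q (suc y))))
countF-remove {suc n} {q} (suc a) qa with q zero
... | true = cong suc (trans (countF-remove a qa) (cong suc (countF-cong λ y → cong (λ b → q (suc y) ∧ not b) (sym ⌊suc≟suc⌋))))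
... | false = trans (countF-remove a qa) (cong suc (countF-cong λ y → cong (λ b → q (suc y) ∧ not b) (sym ⌊suc≟suc⌋)))

countF-bijection : ∀ {p : Fin n → Bool} {q : Fin k → Bool} (g : Fin n → Fin k)
                 → (∀ {x} → p x ≡ true → q (g x) ≡ true)
                 → (∀ {x y} → p x ≡ true → p y ≡ true → g x ≡ g y → x ≡ y)
                 → (∀ {a} → q a ≡ true → ∃ λ x → p x ≡ true × g x ≡ a)
                 → countF p ≡ countF q
countF-bijection {zero} {q = q} g _ _ onto = sym (countF-false {p = q} λ a → ¬-not λ qa → Fin.¬Fin0 (proj₁ (onto qa)))
countF-bijection {suc n} {p = p} {q} g maps inj onto with p zero in p0
... | false = countF-bijection (g ∘ suc) maps (λ px py → Fin.suc-injective ∘ inj px py) onto′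
  where
  onto′ : ∀ {a} → q a ≡ true → ∃ λ x → p (suc x) ≡ true × g (suc x) ≡ a
  onto′ qa with onto qa
  ... | zero , pz , _ with () ← trans (sym pz) p0
  ... | suc x , px , gx = x , px , gx
... | true = trans (cong suc (countF-bijection (g ∘ suc) maps′ (λ px py → Fin.suc-injective ∘ inj px py) onto′))
                   (sym (countF-remove (g zero) (maps p0)))
  where
  g≢g0 : ∀ {x} → p (suc x) ≡ true → g (suc x) ≢ g zero
  g≢g0 px e with () ← inj px p0 e
  maps′ : ∀ {x} → p (suc x) ≡ true → q (g (suc x)) ∧ not ⌊ g (suc x) ≟ g zero ⌋ ≡ true
  maps′ px rewrite maps px | ≟-false⁺ (g≢g0 px) = refl
  onto′ : ∀ {a} → q a ∧ not ⌊ a ≟ g zero ⌋ ≡ true → ∃ λ x → p (suc x) ≡ true × g (suc x) ≡ a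
  onto′ {a} q′a with onto (∧-conicalˡ _ _ q′a)
  ... | zero , _ , g0≡a = contradiction (sym g0≡a) (≟-false⁻ (not-injective (∧-conicalʳ (q a) _ q′a)))
  ... | suc x , px , gx = x , px , gx

∈-tabulate⁺ : ∀ {p : Fin n → Bool} → p x ≡ true → x ∈ tabulate p
∈-tabulate⁺ {x = x} {p} px = lookup⇒[]= x (tabulate p) (trans (lookup∘tabulate p x) px)

∈-tabulate⁻ : ∀ {p : Fin n → Bool} → x ∈ tabulate p → p x ≡ true
∈-tabulate⁻ {x = x} {p} x∈ = trans (sym (lookup∘tabulate p x)) ([]=⇒lookup x∈)

∈-class⁺ : ∀ (R : Rel n) → R x y ≡ true → y ∈ class R x
∈-class⁺ R = ∈-tabulate⁺

∈-class⁻ : ∀ (R : Rel n) → y ∈ class R x → R x y ≡ true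
∈-class⁻ R = ∈-tabulate⁻

∈-preimage⁺ : ∀ (π : Fin n → Fin k) → π x ∈ A → x ∈ preimage π A
∈-preimage⁺ π πx∈A = ∈-tabulate⁺ ([]=⇒lookup πx∈A)

∈-preimage⁻ : ∀ (π : Fin n → Fin k) → x ∈ preimage π A → π x ∈ A
∈-preimage⁻ {x = x} {A = A} π x∈ = lookup⇒[]= (π x) A (∈-tabulate⁻ x∈)

∈-image⁺ : ∀ (ι : Fin m → Fin n) → y ∈ B → ι y ∈ image ι B
∈-image⁺ {y = y} ι y∈B =
  ∈-tabulate⁺ (anyF-true⁺ _ y (cong₂ _∧_ (≟-refl (ι y)) ([]=⇒lookup y∈B)))

∈-image⁻ : ∀ (ι : Fin m → Fin n) B → x ∈ image ι B → ∃ λ y → y ∈ B × ι y ≡ x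
∈-image⁻ ι B x∈ =
  let (y , e) = anyF-true⁻ _ (∈-tabulate⁻ x∈) in
  y , lookup⇒[]= y B (∧-conicalʳ _ _ e) , ≟-true⁻ (∧-conicalˡ _ _ e)

x∈p─q⇒x∉q : ∀ (p q : Subset n) → x ∈ p ─ q → x ∉ q
x∈p─q⇒x∉q (inside ∷ p) (inside ∷ q) () here
x∈p─q⇒x∉q (outside ∷ p) (inside ∷ q) () here
x∈p─q⇒x∉q (_ ∷ p) (_ ∷ q) (there x∈) (there x∈q) = x∈p─q⇒x∉q p q x∈ x∈q

p─q⊆∁q : ∀ (p q : Subset n) → p ─ q ⊆ ∁ q
p─q⊆∁q p q = x∉p⇒x∈∁p ∘ x∈p─q⇒x∉q p q

p⊆q⇒p∩q≡p : ∀ (p q : Subset n) → p ⊆ q → p ∩ q ≡ p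
p⊆q⇒p∩q≡p p q p⊆q = ⊆-antisym (p∩q⊆p p q) (λ x∈p → x∈p∩q⁺ (x∈p , p⊆q x∈p))

p⊆q⇒p─q≡⊥ : ∀ (p q : Subset n) → p ⊆ q → p ─ q ≡ ⊥
p⊆q⇒p─q≡⊥ p q p⊆q = Empty-unique λ (_ , x∈) → x∈p─q⇒x∉q p q x∈ (p⊆q (p─q⊆p p q x∈))

r⊆q⇒[p─q]∩r≡⊥ : ∀ (p q r : Subset n) → r ⊆ q → (p ─ q) ∩ r ≡ ⊥
r⊆q⇒[p─q]∩r≡⊥ p q r r⊆q = Empty-unique λ (x , x∈) →
  let (x∈p─q , x∈r) = x∈p∩q⁻ (p ─ q) r x∈ in x∈p─q⇒x∉q p q x∈p─q (r⊆q x∈r)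

r⊆q⇒[p∩q]∩r≡p∩r : ∀ (p q r : Subset n) → r ⊆ q → (p ∩ q) ∩ r ≡ p ∩ r
r⊆q⇒[p∩q]∩r≡p∩r p q r r⊆q = ⊆-antisym
  (λ x∈ → let (x∈p∩q , x∈r) = x∈p∩q⁻ (p ∩ q) r x∈ in x∈p∩q⁺ (p∩q⊆p p q x∈p∩q , x∈r))
  (λ x∈ → let (x∈p , x∈r) = x∈p∩q⁻ p r x∈ in x∈p∩q⁺ (x∈p∩q⁺ (x∈p , r⊆q x∈r) , x∈r))

r⊆∁q⇒[p─q]∩r≡p∩r : ∀ (p q r : Subset n) → r ⊆ ∁ q → (p ─ q) ∩ r ≡ p ∩ r
r⊆∁q⇒[p─q]∩r≡p∩r p q r r⊆∁q = ⊆-antisym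
  (λ x∈ → let (x∈p─q , x∈r) = x∈p∩q⁻ (p ─ q) r x∈ in x∈p∩q⁺ (p─q⊆p p q x∈p─q , x∈r))
  (λ x∈ → let (x∈p , x∈r) = x∈p∩q⁻ p r x∈ in
          x∈p∩q⁺ (x∈p∧x∉q⇒x∈p─q x∈p (x∈∁p⇒x∉p (r⊆∁q x∈r)) , x∈r))

r⊆∁q⇒[p∩q]∩r≡⊥ : ∀ (p q r : Subset n) → r ⊆ ∁ q → (p ∩ q) ∩ r ≡ ⊥
r⊆∁q⇒[p∩q]∩r≡⊥ p q r r⊆∁q = Empty-unique λ (x , x∈) →
  let (x∈p∩q , x∈r) = x∈p∩q⁻ (p ∩ q) r x∈ in x∈∁p⇒x∉p (r⊆∁q x∈r) (p∩q⊆q p q x∈p∩q)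

p⊆r⇒p∩[r─q]≡p─q : ∀ (p q r : Subset n) → p ⊆ r → p ∩ (r ─ q) ≡ p ─ q
p⊆r⇒p∩[r─q]≡p─q p q r p⊆r = ⊆-antisym
  (λ x∈ → let (x∈p , x∈r─q) = x∈p∩q⁻ p (r ─ q) x∈ in x∈p∧x∉q⇒x∈p─q x∈p (x∈p─q⇒x∉q r q x∈r─q))
  (λ x∈ → let x∈p = p─q⊆p p q x∈ in
          x∈p∩q⁺ (x∈p , x∈p∧x∉q⇒x∈p─q (p⊆r x∈p) (x∈p─q⇒x∉q p q x∈)))

q⊆r⇒[p─q]─r≡p─r : ∀ (p q r : Subset n) → q ⊆ r → (p ─ q) ─ r ≡ p ─ r
q⊆r⇒[p─q]─r≡p─r p q r q⊆r = ⊆-antisym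
  (λ x∈ → x∈p∧x∉q⇒x∈p─q (p─q⊆p p q (p─q⊆p _ r x∈)) (x∈p─q⇒x∉q _ r x∈))
  (λ x∈ → let x∉r = x∈p─q⇒x∉q p r x∈ in
          x∈p∧x∉q⇒x∈p─q (x∈p∧x∉q⇒x∈p─q (p─q⊆p p r x∈) (x∉r ∘ q⊆r)) x∉r)

[p─q]∩r≡[p∩r]─q : ∀ (p q r : Subset n) → (p ─ q) ∩ r ≡ (p ∩ r) ─ q
[p─q]∩r≡[p∩r]─q p q r = ⊆-antisym
  (λ x∈ → let (x∈p─q , x∈r) = x∈p∩q⁻ (p ─ q) r x∈ in
          x∈p∧x∉q⇒x∈p─q (x∈p∩q⁺ (p─q⊆p p q x∈p─q , x∈r)) (x∈p─q⇒x∉q p q x∈p─q))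
  (λ x∈ → let (x∈p , x∈r) = x∈p∩q⁻ p r (p─q⊆p _ q x∈) in
          x∈p∩q⁺ (x∈p∧x∉q⇒x∈p─q x∈p (x∈p─q⇒x∉q _ q x∈) , x∈r))

p⊆r⇒p─[r∩q]≡p─q : ∀ (p q r : Subset n) → p ⊆ r → p ─ (r ∩ q) ≡ p ─ q
p⊆r⇒p─[r∩q]≡p─q p q r p⊆r = ⊆-antisym
  (λ x∈ → let x∈p = p─q⊆p p _ x∈ in
          x∈p∧x∉q⇒x∈p─q x∈p λ x∈q → x∈p─q⇒x∉q p _ x∈ (x∈p∩q⁺ (p⊆r x∈p , x∈q)))
  (λ x∈ → x∈p∧x∉q⇒x∈p─q (p─q⊆p p q x∈) (x∈p─q⇒x∉q p q x∈ ∘ p∩q⊆q r q))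

p⊆r⇒p∩[r∩q]≡p∩q : ∀ (p q r : Subset n) → p ⊆ r → p ∩ (r ∩ q) ≡ p ∩ q
p⊆r⇒p∩[r∩q]≡p∩q p q r p⊆r = ⊆-antisym
  (λ x∈ → let (x∈p , x∈r∩q) = x∈p∩q⁻ p _ x∈ in x∈p∩q⁺ (x∈p , p∩q⊆q r q x∈r∩q))
  (λ x∈ → let (x∈p , x∈q) = x∈p∩q⁻ p q x∈ in x∈p∩q⁺ (x∈p , x∈p∩q⁺ (p⊆r x∈p , x∈q)))

⊆-minimal : ∀ {P : Subset n → Set} → (∀ Z → Dec (P Z)) → P W
          → ∃ λ Z → Z ⊆ W × P Z × (∀ Z′ → Z′ ⊆ Z → P Z′ → Z ⊆ Z′)
⊆-minimal {W = W} {P = P} P? PW = descend W (ℕ.<-wellFounded ∣ W ∣) PW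
  where
  descend : ∀ W → Acc ℕ._<_ ∣ W ∣ → P W → ∃ λ Z → Z ⊆ W × P Z × (∀ Z′ → Z′ ⊆ Z → P Z′ → Z ⊆ Z′)
  descend W (acc smaller) PW with anySubset? (λ Z′ → Z′ ⊂? W ×-dec P? Z′)
  ... | yes (Z′ , Z′⊂W , PZ′) =
    let (Z , Z⊆Z′ , PZ , minimal) = descend Z′ (smaller (p⊂q⇒∣p∣<∣q∣ Z′⊂W)) PZ′ in
    Z , ⊆-trans Z⊆Z′ (proj₁ Z′⊂W) , PZ , minimal
  ... | no none = W , ⊆-refl , PW , λ Z′ Z′⊆W PZ′ {x} x∈W →
    decidable-stable (x ∈? Z′) λ x∉Z′ → none (Z′ , (Z′⊆W , x , x∈W , x∉Z′) , PZ′)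

Covers : (Fin m → Fin n) → Subset n → Set
Covers ι C = ∀ {x} → x ∈ C → ∃ λ y → ι y ≡ x

module _ (ι : Fin m → Fin n) where

  preimage-mono : A ⊆ C → preimage ι A ⊆ preimage ι C
  preimage-mono A⊆C = ∈-preimage⁺ ι ∘ A⊆C ∘ ∈-preimage⁻ ι

  preimage-⊥ : preimage ι ⊥ ≡ ⊥
  preimage-⊥ = Empty-unique λ (_ , y∈) → ∉⊥ (∈-preimage⁻ ι y∈)

  image-⊥ : image ι ⊥ ≡ ⊥
  image-⊥ = Empty-unique λ (_ , x∈) → ∉⊥ (proj₁ (proj₂ (∈-image⁻ ι ⊥ x∈)))

  image-⊆ : B ⊆ preimage ι C → image ι B ⊆ C
  image-⊆ {B = B} {C = C} B⊆ x∈ = let (y , y∈B , ιy≡x) = ∈-image⁻ ι B x∈ in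
    subst (_∈ C) ιy≡x (∈-preimage⁻ ι (B⊆ y∈B))

  image-preimage : Covers ι A → image ι (preimage ι A) ≡ A
  image-preimage {A = A} covers = ⊆-antisym (image-⊆ ⊆-refl) λ x∈A →
    let (y , ιy≡x) = covers x∈A in
    subst (_∈ image ι (preimage ι A)) ιy≡x (∈-image⁺ ι (∈-preimage⁺ ι (subst (_∈ A) (sym ιy≡x) x∈A)))

  preimage-image : Injective ι → preimage ι (image ι B) ≡ B
  preimage-image {B = B} injective = ⊆-antisym
    (λ y∈ → let (y′ , y′∈B , ιy′≡ιy) = ∈-image⁻ ι B (∈-preimage⁻ ι y∈) in
            subst (_∈ B) (injective _ _ ιy′≡ιy) y′∈B)
    (∈-preimage⁺ ι ∘ ∈-image⁺ ι)

  image-─ : ∀ B Z → image ι B ─ Z ≡ image ι (B ─ preimage ι Z)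
  image-─ B Z = ⊆-antisym
    (λ x∈ → let (y , y∈B , ιy≡x) = ∈-image⁻ ι B (p─q⊆p _ Z x∈)
                y∉ = λ y∈Z → x∈p─q⇒x∉q _ Z x∈ (subst (_∈ Z) ιy≡x (∈-preimage⁻ ι y∈Z))
            in subst (_∈ image ι (B ─ preimage ι Z)) ιy≡x (∈-image⁺ ι (x∈p∧x∉q⇒x∈p─q y∈B y∉)))
    (λ x∈ → let (y , y∈ , ιy≡x) = ∈-image⁻ ι (B ─ preimage ι Z) x∈
                x∈B = subst (_∈ image ι B) ιy≡x (∈-image⁺ ι (p─q⊆p B _ y∈))
            in x∈p∧x∉q⇒x∈p─q x∈B λ x∈Z →
                 x∈p─q⇒x∉q B _ y∈ (∈-preimage⁺ ι (subst (_∈ Z) (sym ιy≡x) x∈Z)))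

  image-∩ : ∀ B Z → image ι B ∩ Z ≡ image ι (B ∩ preimage ι Z)
  image-∩ B Z = ⊆-antisym
    (λ x∈ → let (x∈img , x∈Z) = x∈p∩q⁻ _ Z x∈
                (y , y∈B , ιy≡x) = ∈-image⁻ ι B x∈img
            in subst (_∈ image ι (B ∩ preimage ι Z)) ιy≡x
                 (∈-image⁺ ι (x∈p∩q⁺ (y∈B , ∈-preimage⁺ ι (subst (_∈ Z) (sym ιy≡x) x∈Z)))))
    (λ x∈ → let (y , y∈ , ιy≡x) = ∈-image⁻ ι (B ∩ preimage ι Z) x∈
                (y∈B , y∈Z) = x∈p∩q⁻ B _ y∈
            in x∈p∩q⁺ (subst (_∈ image ι B) ιy≡x (∈-image⁺ ι y∈B) , subst (_∈ Z) ιy≡x (∈-preimage⁻ ι y∈Z)))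

preimage-∘ : ∀ (π : Fin n → Fin k) (ρ : Fin k → Fin m) A → preimage π (preimage ρ A) ≡ preimage (ρ ∘ π) A
preimage-∘ π ρ A = tabulate-cong λ x → lookup∘tabulate (λ y → lookup A (ρ y)) (π x)

-- The inclusion of p, in the form required by restrict and Split.
enum : (p : Subset n) → Fin ∣ p ∣ → Fin n
enum (inside ∷ p) zero = zero
enum (inside ∷ p) (suc u) = suc (enum p u)
enum (outside ∷ p) u = suc (enum p u)

enum-∈ : ∀ (p : Subset n) u → enum p u ∈ p
enum-∈ (inside ∷ p) zero = here
enum-∈ (inside ∷ p) (suc u) = there (enum-∈ p u)
enum-∈ (outside ∷ p) u = there (enum-∈ p u)

enum-injective : ∀ (p : Subset n) → Injective (enum p)
enum-injective (inside ∷ p) zero zero _ = refl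
enum-injective (inside ∷ p) zero (suc v) ()
enum-injective (inside ∷ p) (suc u) zero ()
enum-injective (inside ∷ p) (suc u) (suc v) e = cong suc (enum-injective p u v (Fin.suc-injective e))
enum-injective (outside ∷ p) u v e = enum-injective p u v (Fin.suc-injective e)

enum-onto : ∀ (p : Subset n) → x ∈ p → ∃ λ u → enum p u ≡ x
enum-onto (inside ∷ p) here = zero , refl
enum-onto (inside ∷ p) (there x∈p) = let (u , e) = enum-onto p x∈p in suc u , cong suc e
enum-onto (outside ∷ p) (there x∈p) = let (u , e) = enum-onto p x∈p in u , cong suc e

enum-split : ∀ (p : Subset n) → Split (enum p) (enum (∁ p))
enum-split p = enum-injective p , enum-injective (∁ p) , disjoint , cover
  where
  disjoint : ∀ u v → enum p u ≢ enum (∁ p) v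
  disjoint u v e = x∈p⇒x∉∁p (enum-∈ p u) (subst (_∈ ∁ p) (sym e) (enum-∈ (∁ p) v))
  cover : ∀ x → (∃ λ u → enum p u ≡ x) ⊎ (∃ λ v → enum (∁ p) v ≡ x)
  cover x with x ∈? p
  ... | yes x∈p = inj₁ (enum-onto p x∈p)
  ... | no x∉p = inj₂ (enum-onto (∁ p) (x∉p⇒x∈∁p x∉p))

Closed : Rel n → Subset n → Set
Closed R C = ∀ {x y} → R x y ≡ true → x ∈ C → y ∈ C

<ᵇ-true : ∀ {i j} → i ℕ.< j → (i <ᵇ j) ≡ true
<ᵇ-true i<j = Equivalence.to T-≡ (ℕ.<⇒<ᵇ i<j)

¬isMin⇒below : ∀ (R : Rel n) → isMin R x ≡ false → ∃ λ y → toℕ y ℕ.< toℕ x × R y x ≡ true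
¬isMin⇒below R e =
  let (y , b) = anyF-true⁻ _ (not-injective e) in
  y , ℕ.<ᵇ⇒< _ _ (Equivalence.from T-≡ (∧-conicalˡ _ _ b)) , ∧-conicalʳ _ _ b

below⇒¬isMin : ∀ (R : Rel n) → toℕ y ℕ.< toℕ x → R y x ≡ true → isMin R x ≡ false
below⇒¬isMin {y = y} R y<x Ryx = cong not (anyF-true⁺ _ y (cong₂ _∧_ (<ᵇ-true y<x) Ryx))

isMin-antitone : S ⊆R R → isMin R x ≡ true → isMin S x ≡ true
isMin-antitone {S = S} {R = R} {x = x} S⊆R min-R with isMin S x in min-S
... | true = refl
... | false = let (y , y<x , Syx) = ¬isMin⇒below S min-S in
              sym (trans (sym min-R) (below⇒¬isMin R y<x (S⊆R y x Syx)))

module EquivRel {R : Rel n} (eq : IsEquiv R) where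

  reflexive : ∀ x → R x x ≡ true
  reflexive = proj₁ eq

  symmetric : R x y ≡ true → R y x ≡ true
  symmetric = proj₁ (proj₂ eq) _ _

  transitive : R x y ≡ true → R y z ≡ true → R x z ≡ true
  transitive = proj₂ (proj₂ eq) _ _ _

  symmetric≡ : R x y ≡ R y x
  symmetric≡ = bool-ext symmetric symmetric

  ∈-class-self : ∀ x → x ∈ class R x
  ∈-class-self x = ∈-class⁺ R (reflexive x)

  class-closed : ∀ x → Closed R (class R x)
  class-closed x Ryz y∈ = ∈-class⁺ R (transitive (∈-class⁻ R y∈) Ryz)

  class-related : y ∈ class R x → z ∈ class R x → R y z ≡ true
  class-related y∈ z∈ = transitive (symmetric (∈-class⁻ R y∈)) (∈-class⁻ R z∈)

  class-≡ : R x y ≡ true → class R x ≡ class R y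
  class-≡ Rxy = ⊆-antisym (∈-class⁺ R ∘ transitive (symmetric Rxy) ∘ ∈-class⁻ R)
                          (∈-class⁺ R ∘ transitive Rxy ∘ ∈-class⁻ R)

  isMin-unique : isMin R x ≡ true → isMin R y ≡ true → R x y ≡ true → x ≡ y
  isMin-unique {x} {y} min-x min-y Rxy with ℕ.<-cmp (toℕ x) (toℕ y)
  ... | tri< x<y _ _ = contradiction (trans (sym min-y) (below⇒¬isMin R x<y Rxy)) λ ()
  ... | tri≈ _ x≡y _ = Fin.toℕ-injective x≡y
  ... | tri> _ _ y<x = contradiction (trans (sym min-x) (below⇒¬isMin R y<x (symmetric Rxy))) λ ()

  representative : ∀ x → ∃ λ r → isMin R r ≡ true × R r x ≡ true
  representative x = descend x (<-wellFounded x)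
    where
    descend : ∀ x → Acc Fin._<_ x → ∃ λ r → isMin R r ≡ true × R r x ≡ true
    descend x (acc smaller) with isMin R x in min-x
    ... | true = x , min-x , reflexive x
    ... | false = let (b , b<x , Rbx) = ¬isMin⇒below R min-x
                      (r , min-r , Rrb) = descend b (smaller b<x)
                  in r , min-r , transitive Rrb Rbx

  rep : Fin n → Fin n
  rep x = proj₁ (representative x)

  rep-isMin : ∀ x → isMin R (rep x) ≡ true
  rep-isMin x = proj₁ (proj₂ (representative x))

  rep-related : ∀ x → R (rep x) x ≡ true
  rep-related x = proj₂ (proj₂ (representative x))

  related⇒rep≡ : R x y ≡ true → rep x ≡ rep y
  related⇒rep≡ {x} {y} Rxy = isMin-unique (rep-isMin x) (rep-isMin y)
    (transitive (rep-related x) (transitive Rxy (symmetric (rep-related y))))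

  rep≡⇒related : rep x ≡ rep y → R x y ≡ true
  rep≡⇒related {x} {y} rx≡ry =
    transitive (symmetric (rep-related x)) (subst (λ r → R r y ≡ true) (sym rx≡ry) (rep-related y))

  isMin-via-class : isMin R x ≡ not (anyF (λ y → (toℕ y <ᵇ toℕ x) ∧ lookup (class R x) y))
  isMin-via-class {x} = cong not (anyF-cong λ y → cong ((toℕ y <ᵇ toℕ x) ∧_)
                                   (trans symmetric≡ (sym (lookup∘tabulate (R x) y))))

isMin-cong : IsEquiv R → IsEquiv S → class R x ≡ class S x → isMin R x ≡ isMin S x
isMin-cong {x = x} eqR eqS e =
  trans (EquivRel.isMin-via-class eqR)
        (trans (cong (λ K → not (anyF λ y → (toℕ y <ᵇ toℕ x) ∧ lookup K y)) e)
               (sym (EquivRel.isMin-via-class eqS)))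

classes-agree : IsEquiv R → IsEquiv S → (∀ {x} → x ∈ A → class R x ≡ class S x)
              → y ∈ A → y ∈ class R x → class R x ≡ class S x
classes-agree {R = R} {S = S} {y = y} {x = x} eqR eqS same y∈A y∈x =
  trans Rx≡Ry (trans (same y∈A) (S.class-≡ (∈-class⁻ S x∈Sy)))
  where
  module R = EquivRel eqR
  module S = EquivRel eqS
  Rx≡Ry : class R x ≡ class R y
  Rx≡Ry = R.class-≡ (∈-class⁻ R y∈x)
  x∈Sy : x ∈ class S y
  x∈Sy = subst (x ∈_) (trans Rx≡Ry (same y∈A)) (R.∈-class-self x)

cl-quotient : ∀ {π : Fin n → Fin k} → IsEquiv R → QuotRep R π → cl R ≡ k
cl-quotient {R = R} {π = π} eq (π-onto , π-kernel) =
  trans (countF-bijection π (λ _ → refl) injective onto) countF-true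
  where
  open EquivRel eq
  injective : ∀ {x y} → isMin R x ≡ true → isMin R y ≡ true → π x ≡ π y → x ≡ y
  injective min-x min-y πx≡πy = isMin-unique min-x min-y (Equivalence.to (π-kernel _ _) πx≡πy)
  onto : ∀ {a} → true ≡ true → ∃ λ r → isMin R r ≡ true × π r ≡ a
  onto {a} _ = let (x , πx≡a) = π-onto a in
               rep x , rep-isMin x , trans (Equivalence.from (π-kernel (rep x) x) (rep-related x)) πx≡a

cl-≡⇒⊇ : IsEquiv R → IsEquiv S → S ⊆R R → cl S ≡ cl R → R ⊆R S
cl-≡⇒⊇ {R = R} {S = S} eqR eqS S⊆R clS≡clR x y Rxy =
  S.rep≡⇒related (R.isMin-unique (S-min⇒R-min (S.rep-isMin x)) (S-min⇒R-min (S.rep-isMin y))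
    (R.transitive (S⊆R _ _ (S.rep-related x)) (R.transitive Rxy (R.symmetric (S⊆R _ _ (S.rep-related y))))))
  where
  module R = EquivRel eqR
  module S = EquivRel eqS
  S-min⇒R-min : ∀ {x} → isMin S x ≡ true → isMin R x ≡ true
  S-min⇒R-min = countF-≡⇒⊇ {p = isMin R} {q = isMin S} (λ _ → isMin-antitone S⊆R) (sym clS≡clR) _

idRel-isEquiv : IsEquiv (idRel {n})
idRel-isEquiv = ≟-refl
              , (λ x _ x≡y → subst (λ t → ⌊ t ≟ x ⌋ ≡ true) (≟-true⁻ x≡y) (≟-refl x))
              , λ x _ _ x≡y y≡z → subst (λ t → ⌊ x ≟ t ⌋ ≡ true) (≟-true⁻ y≡z) x≡y

pullRel-isEquiv : ∀ (ι : Fin m → Fin n) → IsEquiv R → IsEquiv (pullRel ι R)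
pullRel-isEquiv ι (r , s , t) = r ∘ ι , (λ x y → s (ι x) (ι y)) , λ x y z → t (ι x) (ι y) (ι z)

class-pullRel : ∀ (ι : Fin m → Fin n) u → class (pullRel ι R) u ≡ preimage ι (class R (ι u))
class-pullRel {R = R} ι u = tabulate-cong λ v → sym (lookup∘tabulate (R (ι u)) (ι v))

Closed-∁ : IsEquiv R → Closed R C → Closed R (∁ C)
Closed-∁ eq closed Rxy x∈∁C = x∉p⇒x∈∁p λ y∈C → x∈∁p⇒x∉p x∈∁C (closed (EquivRel.symmetric eq Rxy) y∈C)

Closed-NoCross : IsEquiv R → Closed R C → NoCross (enum C) (enum (∁ C)) R
Closed-NoCross {R = R} {C = C} eq closed u v =
  ¬-not (crossing u v) , ¬-not (crossing u v ∘ EquivRel.symmetric eq)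
  where
  crossing : ∀ u v → R (enum C u) (enum (∁ C) v) ≢ true
  crossing u v Ruv = x∈∁p⇒x∉p (enum-∈ (∁ C) v) (closed Ruv (enum-∈ C u))

Closed-covers : Closed R C → x ∈ C → Covers (enum C) (class R x)
Closed-covers {R = R} {C = C} closed x∈C y∈ = enum-onto C (closed (∈-class⁻ R y∈) x∈C)

withClass : Subset n → Rel n → Rel n
withClass Z R x y = if lookup Z x then lookup Z y else not (lookup Z y) ∧ R x y

module WithClass (Z : Subset n) {R : Rel n} (eq : IsEquiv R) where
  open EquivRel eq

  ∉⇒lookup : x ∉ Z → lookup Z x ≡ false
  ∉⇒lookup x∉Z = ¬-not (x∉Z ∘ lookup⇒[]= _ Z)

  inside≡ : x ∈ Z → withClass Z R x y ≡ lookup Z y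
  inside≡ x∈Z rewrite []=⇒lookup x∈Z = refl

  outside≡ : x ∉ Z → withClass Z R x y ≡ not (lookup Z y) ∧ R x y
  outside≡ x∉Z rewrite ∉⇒lookup x∉Z = refl

  inside⁺ : x ∈ Z → y ∈ Z → withClass Z R x y ≡ true
  inside⁺ x∈Z y∈Z = trans (inside≡ x∈Z) ([]=⇒lookup y∈Z)

  inside⁻ : x ∈ Z → withClass Z R x y ≡ true → y ∈ Z
  inside⁻ x∈Z xy = lookup⇒[]= _ Z (trans (sym (inside≡ x∈Z)) xy)

  outside⁺ : x ∉ Z → y ∉ Z → R x y ≡ true → withClass Z R x y ≡ true
  outside⁺ {y = y} x∉Z y∉Z Rxy rewrite outside≡ {y = y} x∉Z | ∉⇒lookup y∉Z = Rxy

  outside⁻ : x ∉ Z → withClass Z R x y ≡ true → y ∉ Z × R x y ≡ true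
  outside⁻ {y = y} x∉Z xy =
    let b = trans (sym (outside≡ x∉Z)) xy in
    (λ y∈Z → contradiction (trans (sym (cong not ([]=⇒lookup y∈Z))) (∧-conicalˡ _ _ b)) λ ()) ,
    ∧-conicalʳ (not (lookup Z y)) _ b

  isEquiv : IsEquiv (withClass Z R)
  isEquiv = reflexive′ , (λ _ _ → symmetric′) , λ _ _ _ → transitive′
    where
    reflexive′ : ∀ x → withClass Z R x x ≡ true
    reflexive′ x with x ∈? Z
    ... | yes x∈Z = inside⁺ x∈Z x∈Z
    ... | no x∉Z = outside⁺ x∉Z x∉Z (reflexive x)
    symmetric′ : withClass Z R x y ≡ true → withClass Z R y x ≡ true
    symmetric′ {x} xy with x ∈? Z
    ... | yes x∈Z = inside⁺ (inside⁻ x∈Z xy) x∈Z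
    ... | no x∉Z = let (y∉Z , Rxy) = outside⁻ x∉Z xy in outside⁺ y∉Z x∉Z (symmetric Rxy)
    transitive′ : withClass Z R x y ≡ true → withClass Z R y z ≡ true → withClass Z R x z ≡ true
    transitive′ {x} xy yz with x ∈? Z
    ... | yes x∈Z = inside⁺ x∈Z (inside⁻ (inside⁻ x∈Z xy) yz)
    ... | no x∉Z = let (y∉Z , Rxy) = outside⁻ x∉Z xy
                       (z∉Z , Ryz) = outside⁻ y∉Z yz
                   in outside⁺ x∉Z z∉Z (transitive Rxy Ryz)

  Z-closed : Closed (withClass Z R) Z
  Z-closed xy x∈Z = inside⁻ x∈Z xy

  class-inside : x ∈ Z → class (withClass Z R) x ≡ Z
  class-inside x∈Z = ⊆-antisym (inside⁻ x∈Z ∘ ∈-class⁻ (withClass Z R)) (∈-class⁺ (withClass Z R) ∘ inside⁺ x∈Z)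

  class-outside : class R x ⊆ ∁ Z → class (withClass Z R) x ≡ class R x
  class-outside {x} Rx⊆∁Z = ⊆-antisym
    (∈-class⁺ R ∘ proj₂ ∘ outside⁻ x∉Z ∘ ∈-class⁻ (withClass Z R))
    (λ y∈ → ∈-class⁺ (withClass Z R) (outside⁺ x∉Z (x∈∁p⇒x∉p (Rx⊆∁Z y∈)) (∈-class⁻ R y∈)))
    where
    x∉Z : x ∉ Z
    x∉Z = x∈∁p⇒x∉p (Rx⊆∁Z (∈-class-self x))

quotient : IsEquiv R → Σ ℕ λ k → Σ (Fin n → Fin k) (QuotRep R)
quotient {n = n} {R = R} eq = ∣ reps ∣ , π , onto , λ x y → mk⇔ (rep≡⇒related ∘ π≡⇒rep≡) (rep≡⇒π≡ ∘ related⇒rep≡)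
  where
  open EquivRel eq
  reps : Subset n
  reps = tabulate (isMin R)
  π : Fin n → Fin ∣ reps ∣
  π x = proj₁ (enum-onto reps (∈-tabulate⁺ (rep-isMin x)))
  enum-π : ∀ x → enum reps (π x) ≡ rep x
  enum-π x = proj₂ (enum-onto reps (∈-tabulate⁺ (rep-isMin x)))
  π≡⇒rep≡ : π x ≡ π y → rep x ≡ rep y
  π≡⇒rep≡ {x} {y} πx≡πy = trans (sym (enum-π x)) (trans (cong (enum reps) πx≡πy) (enum-π y))
  rep≡⇒π≡ : rep x ≡ rep y → π x ≡ π y
  rep≡⇒π≡ {x} {y} rx≡ry = enum-injective reps _ _ (trans (enum-π x) (trans rx≡ry (sym (enum-π y))))
  onto : Surjective π
  onto a = let r = enum reps a
               min-r = ∈-tabulate⁻ (enum-∈ reps a)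
           in r , enum-injective reps _ _ (trans (enum-π r)
                    (isMin-unique (rep-isMin r) min-r (rep-related r)))

barRel-true⁺ : ∀ (π : Fin n → Fin k) → R x y ≡ true → barRel π R (π x) (π y) ≡ true
barRel-true⁺ {x = x} {y = y} π Rxy =
  anyF-true⁺ _ x (anyF-true⁺ _ y (cong₂ _∧_ (≟-refl (π x)) (cong₂ _∧_ (≟-refl (π y)) Rxy)))

barRel-true⁻ : ∀ (π : Fin n → Fin k) {a b} → barRel π R a b ≡ true
             → ∃₂ λ x y → π x ≡ a × π y ≡ b × R x y ≡ true
barRel-true⁻ {R = R} π {a} {b} e =
  let (x , e′) = anyF-true⁻ _ e
      (y , e″) = anyF-true⁻ _ e′
      rest = ∧-conicalʳ ⌊ π x ≟ a ⌋ _ e″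
  in x , y , ≟-true⁻ (∧-conicalˡ ⌊ π x ≟ a ⌋ _ e″) , ≟-true⁻ (∧-conicalˡ ⌊ π y ≟ b ⌋ (R x y) rest)
   , ∧-conicalʳ ⌊ π y ≟ b ⌋ (R x y) rest

QuotRep-∘ : ∀ {π : Fin n → Fin k} {ρ : Fin k → Fin m} → QuotRep R π → IsEquiv S → R ⊆R S
          → QuotRep (barRel π S) ρ → QuotRep S (ρ ∘ π)
QuotRep-∘ {S = S} {π = π} {ρ} (π-onto , π-kernel) eqS R⊆S (ρ-onto , ρ-kernel) = onto , kernel
  where
  open EquivRel eqS
  onto : Surjective (ρ ∘ π)
  onto c = let (b , ρb≡c) = ρ-onto c
               (x , πx≡b) = π-onto b
           in x , trans (cong ρ πx≡b) ρb≡c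
  kernel : ∀ x y → (ρ (π x) ≡ ρ (π y)) ⇔ (S x y ≡ true)
  kernel x y = mk⇔ to (Equivalence.from (ρ-kernel (π x) (π y)) ∘ barRel-true⁺ π)
    where
    to : ρ (π x) ≡ ρ (π y) → S x y ≡ true
    to e = let (x′ , y′ , πx′≡πx , πy′≡πy , Sx′y′) = barRel-true⁻ π (Equivalence.to (ρ-kernel (π x) (π y)) e)
               Sx′x = R⊆S _ _ (Equivalence.to (π-kernel x′ x) πx′≡πx)
               Sy′y = R⊆S _ _ (Equivalence.to (π-kernel y′ y) πy′≡πy)
           in transitive (symmetric Sx′x) (transitive Sx′y′ Sy′y)

-- Sums over the classes of an equivalence

module _ {f : BFun n} (f⊥ : f ⊥ ≡ 0ℤ) where

  split-inside : ∀ A → K ⊆ C → f (A ∩ K) ≡ f ((A ─ C) ∩ K) + f ((A ∩ C) ∩ K)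
  split-inside {K} {C} A K⊆C = begin
    f (A ∩ K)                          ≡⟨ ℤ.+-identityˡ _ ⟨
    0ℤ + f (A ∩ K)                     ≡⟨ cong (_+ f (A ∩ K)) f⊥ ⟨
    f ⊥ + f (A ∩ K)                    ≡⟨ cong₂ (λ U V → f U + f V) (r⊆q⇒[p─q]∩r≡⊥ A C K K⊆C)
                                                                   (r⊆q⇒[p∩q]∩r≡p∩r A C K K⊆C) ⟨
    f ((A ─ C) ∩ K) + f ((A ∩ C) ∩ K)  ∎
    where open ≡-Reasoning

  split-outside : ∀ A → K ⊆ ∁ C → f (A ∩ K) ≡ f ((A ─ C) ∩ K) + f ((A ∩ C) ∩ K)
  split-outside {K} {C} A K⊆∁C = begin
    f (A ∩ K)                          ≡⟨ ℤ.+-identityʳ _ ⟨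
    f (A ∩ K) + 0ℤ                     ≡⟨ cong (f (A ∩ K) +_) f⊥ ⟨
    f (A ∩ K) + f ⊥                    ≡⟨ cong₂ (λ U V → f U + f V) (r⊆∁q⇒[p─q]∩r≡p∩r A C K K⊆∁C)
                                                                   (r⊆∁q⇒[p∩q]∩r≡⊥ A C K K⊆∁C) ⟨
    f ((A ─ C) ∩ K) + f ((A ∩ C) ∩ K)  ∎
    where open ≡-Reasoning

  restrictSum-⊥ : ∀ (R : Rel n) → restrictSum f R ⊥ ≡ 0ℤ
  restrictSum-⊥ R = sumZ-zero λ x → if-zero (isMin R x) (trans (cong f (∩-zeroˡ (class R x))) f⊥)

  restrictSum-split : IsEquiv R → Closed R C → ∀ A
                    → restrictSum f R A ≡ restrictSum f R (A ─ C) + restrictSum f R (A ∩ C)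
  restrictSum-split {R} {C} eq closed A =
    trans (sumZ-cong λ x → if-+ (isMin R x) (split-class x))
          (sumZ-+ (λ x → if isMin R x then f ((A ─ C) ∩ class R x) else 0ℤ)
                  (λ x → if isMin R x then f ((A ∩ C) ∩ class R x) else 0ℤ))
    where
    open EquivRel eq
    split-class : ∀ x → f (A ∩ class R x) ≡ f ((A ─ C) ∩ class R x) + f ((A ∩ C) ∩ class R x)
    split-class x with x ∈? C
    ... | yes x∈C = split-inside A λ y∈ → closed (∈-class⁻ R y∈) x∈C
    ... | no x∉C = split-outside A λ y∈ → x∉p⇒x∈∁p λ y∈C → x∉C (closed (symmetric (∈-class⁻ R y∈)) y∈C)

  restrictSum-class : IsEquiv R → ∀ w → A ⊆ class R w → restrictSum f R A ≡ f A
  restrictSum-class {R} {A} eq w A⊆w =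
    trans (sumZ-single _ (rep w) others)
          (trans (cong (λ b → if b then f (A ∩ class R (rep w)) else 0ℤ) (rep-isMin w))
                 (cong f (p⊆q⇒p∩q≡p A _ A⊆rep)))
    where
    open EquivRel eq
    A⊆rep : A ⊆ class R (rep w)
    A⊆rep = subst (A ⊆_) (sym (class-≡ (rep-related w))) A⊆w
    others : ∀ x → x ≢ rep w → (if isMin R x then f (A ∩ class R x) else 0ℤ) ≡ 0ℤ
    others x x≢r with isMin R x in min-x
    ... | false = refl
    ... | true = trans (cong f (Empty-unique λ (y , y∈) →
                   let (y∈A , y∈x) = x∈p∩q⁻ A (class R x) y∈ in
                   x≢r (isMin-unique min-x (rep-isMin w)
                          (transitive (∈-class⁻ R y∈x) (symmetric (∈-class⁻ R (A⊆rep y∈A))))))) f⊥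

  restrictSum-cong : IsEquiv R → IsEquiv S → (∀ {x} → x ∈ A → class R x ≡ class S x)
                   → restrictSum f R A ≡ restrictSum f S A
  restrictSum-cong {R} {S} {A} eqR eqS same = sumZ-cong summand-cong
    where
    summand : Rel n → Fin n → ℤ
    summand R x = if isMin R x then f (A ∩ class R x) else 0ℤ
    summand-≡ : class R x ≡ class S x → summand R x ≡ summand S x
    summand-≡ e = cong₂ (λ b K → if b then f (A ∩ K) else 0ℤ) (isMin-cong eqR eqS e) e
    summand-zero : ∀ (R : Rel n) x → Empty (A ∩ class R x) → summand R x ≡ 0ℤ
    summand-zero R x empty = if-zero (isMin R x) (trans (cong f (Empty-unique empty)) f⊥)
    summand-cong : ∀ x → summand R x ≡ summand S x
    summand-cong x with nonempty? (A ∩ class R x) | nonempty? (A ∩ class S x)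
    ... | yes (y , y∈) | _ =
      let (y∈A , y∈x) = x∈p∩q⁻ A _ y∈ in summand-≡ (classes-agree eqR eqS same y∈A y∈x)
    ... | no _ | yes (y , y∈) =
      let (y∈A , y∈x) = x∈p∩q⁻ A _ y∈ in summand-≡ (sym (classes-agree eqS eqR (sym ∘ same) y∈A y∈x))
    ... | no emptyR | no emptyS = trans (summand-zero R x emptyR) (sym (summand-zero S x emptyS))

-- Splittings and indecomposability

-- f_{|W} = f_{|W ∖ Z} ⋆₁ f_{|Z}
Splits : BFun n → Subset n → Subset n → Set
Splits f W Z = ∀ A → A ⊆ W → f A ≡ f (A ─ Z) + f (A ∩ Z)

splits? : ∀ (f : BFun n) W Z → Dec (Splits f W Z)
splits? f W Z = all-subsets? λ A → A ⊆? W →-dec f A ℤ.≟ f (A ─ Z) + f (A ∩ Z)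
  where
  all-subsets? : ∀ {P : Subset n → Set} → (∀ A → Dec (P A)) → Dec (∀ A → P A)
  all-subsets? P? with anySubset? (¬? ∘ P?)
  ... | yes (A , ¬PA) = no λ all → ¬PA (all A)
  ... | no ¬∃¬P = yes λ A → decidable-stable (P? A) λ ¬PA → ¬∃¬P (A , ¬PA)

Splits-self : f ⊥ ≡ 0ℤ → Splits f W W
Splits-self {f = f} {W = W} f⊥ A A⊆W = begin
  f A              ≡⟨ ℤ.+-identityˡ _ ⟨
  0ℤ + f A         ≡⟨ cong₂ _+_ (trans (sym f⊥) (cong f (sym (p⊆q⇒p─q≡⊥ A W A⊆W))))
                                (cong f (sym (p⊆q⇒p∩q≡p A W A⊆W))) ⟩
  f (A ─ W) + f (A ∩ W)  ∎
  where open ≡-Reasoning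

Splits-∩ : Splits f W Z → C ⊆ W → Splits f C (C ∩ Z)
Splits-∩ {f = f} {Z = Z} {C = C} splits C⊆W A A⊆C =
  trans (splits A (C⊆W ∘ A⊆C))
        (sym (cong₂ (λ U V → f U + f V) (p⊆r⇒p─[r∩q]≡p─q A Z C A⊆C) (p⊆r⇒p∩[r∩q]≡p∩q A Z C A⊆C)))

Splits-trans : Splits f W Z₀ → Z ⊆ Z₀ → Splits f Z₀ Z → Splits f W Z
Splits-trans {f = f} {W = W} {Z₀ = Z₀} {Z = Z} splits₀ Z⊆Z₀ splits A A⊆W = begin
  f A                                            ≡⟨ splits₀ A A⊆W ⟩
  f (A ─ Z₀) + f (A ∩ Z₀)                        ≡⟨ cong (f (A ─ Z₀) +_) (splits (A ∩ Z₀) (p∩q⊆q A Z₀)) ⟩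
  f (A ─ Z₀) + (f ((A ∩ Z₀) ─ Z) + f ((A ∩ Z₀) ∩ Z))  ≡⟨ ℤ.+-assoc (f (A ─ Z₀)) (f ((A ∩ Z₀) ─ Z)) (f ((A ∩ Z₀) ∩ Z)) ⟨
  f (A ─ Z₀) + f ((A ∩ Z₀) ─ Z) + f ((A ∩ Z₀) ∩ Z)    ≡⟨ cong₂ (λ U V → f (A ─ Z₀) + f U + f V)
                                                        (sym ([p─q]∩r≡[p∩r]─q A Z Z₀)) (r⊆q⇒[p∩q]∩r≡p∩r A Z₀ Z Z⊆Z₀) ⟩
  f (A ─ Z₀) + f ((A ─ Z) ∩ Z₀) + f (A ∩ Z)      ≡⟨ cong (λ U → f U + f ((A ─ Z) ∩ Z₀) + f (A ∩ Z))
                                                        (q⊆r⇒[p─q]─r≡p─r A Z Z₀ Z⊆Z₀) ⟨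
  f ((A ─ Z) ─ Z₀) + f ((A ─ Z) ∩ Z₀) + f (A ∩ Z) ≡⟨ cong (_+ f (A ∩ Z)) (splits₀ (A ─ Z) (A⊆W ∘ p─q⊆p A Z)) ⟨
  f (A ─ Z) + f (A ∩ Z)                          ∎
  where open ≡-Reasoning

restrictSum-Splits : ∀ {h : BFun n} → f ⊥ ≡ 0ℤ → IsEquiv R → Closed R C
                   → (∀ A → h A ≡ restrictSum f R A) → Splits h W C
restrictSum-Splits {f = f} {R = R} {C = C} {h = h} f⊥ eq closed h≡ A _ = begin
  h A                                                        ≡⟨ h≡ A ⟩
  restrictSum f R A                                          ≡⟨ restrictSum-split {f = f} f⊥ eq closed A ⟩
  restrictSum f R (A ─ C) + restrictSum f R (A ∩ C)          ≡⟨ cong₂ _+_ (h≡ (A ─ C)) (h≡ (A ∩ C)) ⟨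
  h (A ─ C) + h (A ∩ C)                                      ∎
  where open ≡-Reasoning

IndecOn-split : f ⊥ ≡ 0ℤ → IndecOn f C → Z ⊆ C → Splits f C Z → Z ≡ ⊥ ⊎ Z ≡ C
IndecOn-split {f = f} {C = C} {Z = Z} f⊥ (_ , indecomposable) Z⊆C splits =
  indecomposable Z Z⊆C (f , f , f⊥ , f⊥ , λ A A⊆C →
    trans (splits A A⊆C) (cong (λ U → f U + f (A ∩ Z)) (sym (p⊆r⇒p∩[r─q]≡p─q A Z C A⊆C))))

IndecOn-intro : Nonempty C → (∀ Z → Z ⊆ C → Splits f C Z → Z ≡ ⊥ ⊎ Z ≡ C) → IndecOn f C
IndecOn-intro {C = C} {f = f} nonempty only-trivial =
  nonempty , λ Z Z⊆C (g , h , g⊥ , h⊥ , decomposition) → only-trivial Z Z⊆C λ A A⊆C → begin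
    f A                                            ≡⟨ decomposition A A⊆C ⟩
    g (A ∩ (C ─ Z)) + h (A ∩ Z)                    ≡⟨ cong₂ _+_ (ℤ.+-identityʳ (g (A ∩ (C ─ Z)))) (ℤ.+-identityˡ (h (A ∩ Z))) ⟨
    (g (A ∩ (C ─ Z)) + 0ℤ) + (0ℤ + h (A ∩ Z))      ≡⟨ cong₂ _+_ (cong₂ (λ U V → g U + V)
                                                       (r⊆∁q⇒[p─q]∩r≡p∩r A Z (C ─ Z) (p─q⊆∁q C Z))
                                                       (trans (cong h (r⊆q⇒[p─q]∩r≡⊥ A Z Z id)) h⊥))
                                                     (cong₂ (λ U V → U + h V)
                                                       (trans (cong g (r⊆∁q⇒[p∩q]∩r≡⊥ A Z (C ─ Z) (p─q⊆∁q C Z))) g⊥)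
                                                       (r⊆q⇒[p∩q]∩r≡p∩r A Z Z id)) ⟨
    (g ((A ─ Z) ∩ (C ─ Z)) + h ((A ─ Z) ∩ Z))
      + (g ((A ∩ Z) ∩ (C ─ Z)) + h ((A ∩ Z) ∩ Z))  ≡⟨ cong₂ _+_ (decomposition (A ─ Z) (A⊆C ∘ p─q⊆p A Z))
                                                                (decomposition (A ∩ Z) (A⊆C ∘ p∩q⊆p A Z)) ⟨
    f (A ─ Z) + f (A ∩ Z)                          ∎
  where open ≡-Reasoning

IndecOn-cong : (∀ A → A ⊆ C → g A ≡ f A) → IndecOn f C → IndecOn g C
IndecOn-cong agree (nonempty , indecomposable) = nonempty , λ Z Z⊆C (g′ , h′ , g′⊥ , h′⊥ , decomposition) →
  indecomposable Z Z⊆C (g′ , h′ , g′⊥ , h′⊥ , λ A A⊆C → trans (sym (agree A A⊆C)) (decomposition A A⊆C))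

restrict-⊥ : ∀ (ι : Fin m → Fin n) → f ⊥ ≡ 0ℤ → restrict ι f ⊥ ≡ 0ℤ
restrict-⊥ {f = f} ι f⊥ = trans (cong f (image-⊥ ι)) f⊥

Splits-restrict⁺ : ∀ (ι : Fin m → Fin n) → Splits f C Z → Splits (restrict ι f) (preimage ι C) (preimage ι Z)
Splits-restrict⁺ {f = f} {Z = Z} ι splits B B⊆ =
  trans (splits (image ι B) (image-⊆ ι B⊆)) (cong₂ (λ U V → f U + f V) (image-─ ι B Z) (image-∩ ι B Z))

Splits-restrict⁻ : ∀ (ι : Fin m → Fin n) → Covers ι C
                 → Splits (restrict ι f) (preimage ι C) (preimage ι Z) → Splits f C Z
Splits-restrict⁻ {f = f} {Z = Z} ι covers splits A A⊆C = begin
  f A                                                  ≡⟨ cong f A≡ ⟨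
  f (image ι (preimage ι A))                           ≡⟨ splits (preimage ι A) (preimage-mono ι A⊆C) ⟩
  f (image ι (preimage ι A ─ preimage ι Z))
    + f (image ι (preimage ι A ∩ preimage ι Z))        ≡⟨ cong₂ (λ U V → f U + f V)
                                                            (image-─ ι (preimage ι A) Z) (image-∩ ι (preimage ι A) Z) ⟨
  f (image ι (preimage ι A) ─ Z) + f (image ι (preimage ι A) ∩ Z)  ≡⟨ cong (λ U → f (U ─ Z) + f (U ∩ Z)) A≡ ⟩
  f (A ─ Z) + f (A ∩ Z)                                ∎
  where
  open ≡-Reasoning
  A≡ : image ι (preimage ι A) ≡ A
  A≡ = image-preimage ι λ x∈A → covers (A⊆C x∈A)

IndecOn-restrict⁺ : ∀ (ι : Fin m → Fin n) → f ⊥ ≡ 0ℤ → Injective ι → Covers ι C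
                  → IndecOn f C → IndecOn (restrict ι f) (preimage ι C)
IndecOn-restrict⁺ {f = f} {C = C} ι f⊥ injective covers indec@((x , x∈C) , _) with covers x∈C
... | y , ιy≡x = IndecOn-intro (y , ∈-preimage⁺ ι (subst (_∈ C) (sym ιy≡x) x∈C)) trivial
  where
  trivial : ∀ Z′ → Z′ ⊆ preimage ι C → Splits (restrict ι f) (preimage ι C) Z′ → Z′ ≡ ⊥ ⊎ Z′ ≡ preimage ι C
  trivial Z′ Z′⊆ splits′ =
    Sum.map (λ Z≡⊥ → trans (sym Z′≡) (trans (cong (preimage ι) Z≡⊥) (preimage-⊥ ι)))
            (λ Z≡C → trans (sym Z′≡) (cong (preimage ι) Z≡C))
            (IndecOn-split f⊥ indec (image-⊆ ι Z′⊆)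
              (Splits-restrict⁻ ι covers (subst (Splits (restrict ι f) (preimage ι C)) (sym Z′≡) splits′)))
    where
    Z′≡ : preimage ι (image ι Z′) ≡ Z′
    Z′≡ = preimage-image ι injective

IndecOn-restrict⁻ : ∀ (ι : Fin m → Fin n) → f ⊥ ≡ 0ℤ → Covers ι C
                  → IndecOn (restrict ι f) (preimage ι C) → IndecOn f C
IndecOn-restrict⁻ {f = f} {C = C} ι f⊥ covers indec@((y , y∈) , _) =
  IndecOn-intro (ι y , ∈-preimage⁻ ι y∈) trivial
  where
  trivial : ∀ Z → Z ⊆ C → Splits f C Z → Z ≡ ⊥ ⊎ Z ≡ C
  trivial Z Z⊆C splits with IndecOn-split (restrict-⊥ {f = f} ι f⊥) indec (preimage-mono ι Z⊆C) (Splits-restrict⁺ ι splits)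
  ... | inj₁ Z′≡⊥ = inj₁ (Empty-unique λ (x , x∈Z) → let (y , ιy≡x) = covers (Z⊆C x∈Z) in
          ∉⊥ (subst (y ∈_) Z′≡⊥ (∈-preimage⁺ ι (subst (_∈ Z) (sym ιy≡x) x∈Z))))
  ... | inj₂ Z′≡C′ = inj₂ (⊆-antisym Z⊆C λ x∈C → let (y , ιy≡x) = covers x∈C in
          subst (_∈ Z) ιy≡x (∈-preimage⁻ ι (subst (y ∈_) (sym Z′≡C′) (∈-preimage⁺ ι (subst (_∈ C) (sym ιy≡x) x∈C)))))

ClassesIndec : BFun n → Rel n → Set
ClassesIndec f R = ∀ x → IndecOn f (class R x)

ClassesIndec⇒⊆ : f ⊥ ≡ 0ℤ → IsEquiv R → IsEquiv S → ClassesIndec f R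
               → (∀ x → Splits f ⊤ (class S x)) → R ⊆R S
ClassesIndec⇒⊆ {R = R} {S = S} f⊥ eqR eqS indec splits x y Rxy
  with IndecOn-split f⊥ (indec x) (p∩q⊆p _ _) (Splits-∩ (splits x) ⊆⊤)
... | inj₁ ≡⊥ = contradiction (subst (x ∈_) ≡⊥ (x∈p∩q⁺ (R.∈-class-self x , S.∈-class-self x))) ∉⊥
  where
  module R = EquivRel eqR
  module S = EquivRel eqS
... | inj₂ ≡Rx = ∈-class⁻ S (p∩q⊆q _ _ (subst (y ∈_) (sym ≡Rx) (∈-class⁺ R Rxy)))

restrict-ClassesIndec : f ⊥ ≡ 0ℤ → Closed R C → ClassesIndec f R
                      → ClassesIndec (restrict (enum C) f) (pullRel (enum C) R)
restrict-ClassesIndec {f = f} {R = R} {C = C} f⊥ closed indec u =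
  subst (IndecOn (restrict (enum C) f)) (sym (class-pullRel {R = R} (enum C) u))
    (IndecOn-restrict⁺ (enum C) f⊥ (enum-injective C) (Closed-covers closed (enum-∈ C u)) (indec (enum C u)))

IsIcDecomp-single : f ⊥ ≡ 0ℤ → IsEquiv R → (∀ y → R x y ≡ true) → ClassesIndec f R → IsIcDecomp f R
IsIcDecomp-single {f = f} {R = R} {x = x} f⊥ eq Rx indec =
  (λ A → sym (restrictSum-class {f = f} f⊥ eq x λ {y} _ → ∈-class⁺ R (Rx y))) , indec

Modular-cong : f ≈F g → Modular f → Modular g
Modular-cong {f = f} {g = g} f≈g modular A =
  trans (sym (f≈g A)) (trans (modular A) (sumZ-cong λ x → cong (λ v → if lookup A x then v else 0ℤ) (f≈g ⁅ x ⁆)))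

Modular-Fin1 : ∀ {g : BFun 1} → g ⊥ ≡ 0ℤ → Modular g
Modular-Fin1 _ (inside ∷ []) = sym (ℤ.+-identityʳ _)
Modular-Fin1 g⊥ (outside ∷ []) = g⊥

-- The ic decomposition

minimal-splits⇒IndecOn : Nonempty Z₀ → Splits f W Z₀
                       → (∀ Z → Z ⊆ Z₀ → Nonempty Z × Splits f W Z → Z₀ ⊆ Z) → IndecOn f Z₀
minimal-splits⇒IndecOn {Z₀ = Z₀} {f = f} nonempty splits₀ minimal = IndecOn-intro nonempty trivial
  where
  trivial : ∀ Z → Z ⊆ Z₀ → Splits f Z₀ Z → Z ≡ ⊥ ⊎ Z ≡ Z₀
  trivial Z Z⊆Z₀ splits with nonempty? Z
  ... | yes ne = inj₂ (⊆-antisym Z⊆Z₀ (minimal Z Z⊆Z₀ (ne , Splits-trans splits₀ Z⊆Z₀ splits)))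
  ... | no empty = inj₁ (Empty-unique empty)

module _ {f : BFun n} (f⊥ : f ⊥ ≡ 0ℤ) where

  PartialIcDecomposition : Subset n → Set
  PartialIcDecomposition W =
    Σ (Rel n) λ R → IsEquiv R × Closed R W × (∀ A → A ⊆ W → f A ≡ restrictSum f R A)
                  × (∀ {x} → x ∈ W → IndecOn f (class R x))

  addClass : Z₀ ⊆ W → Nonempty Z₀ → Splits f W Z₀ → IndecOn f Z₀
           → PartialIcDecomposition (W ─ Z₀) → PartialIcDecomposition W
  addClass {Z₀} {W} Z₀⊆W (z₀ , z₀∈Z₀) splits₀ indec₀ (R , eqR , closed , sum , indec) =
    R′ , isEquiv , closed′ , sum′ , indec′
    where
    open WithClass Z₀ eqR
    R′ : Rel n
    R′ = withClass Z₀ R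
    class-R′ : x ∈ W ─ Z₀ → class R′ x ≡ class R x
    class-R′ x∈ = class-outside λ y∈ → p─q⊆∁q W Z₀ (closed (∈-class⁻ R y∈) x∈)
    closed′ : Closed R′ W
    closed′ {x} xy x∈W with x ∈? Z₀
    ... | yes x∈Z₀ = Z₀⊆W (inside⁻ x∈Z₀ xy)
    ... | no x∉Z₀ = p─q⊆p W Z₀ (closed (proj₂ (outside⁻ x∉Z₀ xy)) (x∈p∧x∉q⇒x∈p─q x∈W x∉Z₀))
    sum′ : ∀ A → A ⊆ W → f A ≡ restrictSum f R′ A
    sum′ A A⊆W = begin
      f A                                                    ≡⟨ splits₀ A A⊆W ⟩
      f (A ─ Z₀) + f (A ∩ Z₀)                                ≡⟨ cong₂ _+_ (sum (A ─ Z₀) A─Z₀⊆)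
                                                                  (sym (restrictSum-class {f = f} f⊥ isEquiv z₀ A∩Z₀⊆)) ⟩
      restrictSum f R (A ─ Z₀) + restrictSum f R′ (A ∩ Z₀)   ≡⟨ cong (_+ restrictSum f R′ (A ∩ Z₀))
                                                                  (restrictSum-cong {f = f} f⊥ eqR isEquiv λ x∈ →
                                                                    sym (class-R′ (A─Z₀⊆ x∈))) ⟩
      restrictSum f R′ (A ─ Z₀) + restrictSum f R′ (A ∩ Z₀)  ≡⟨ restrictSum-split {f = f} f⊥ isEquiv Z-closed A ⟨
      restrictSum f R′ A                                     ∎
      where
      open ≡-Reasoning
      A─Z₀⊆ : A ─ Z₀ ⊆ W ─ Z₀
      A─Z₀⊆ x∈ = x∈p∧x∉q⇒x∈p─q (A⊆W (p─q⊆p A Z₀ x∈)) (x∈p─q⇒x∉q A Z₀ x∈)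
      A∩Z₀⊆ : A ∩ Z₀ ⊆ class R′ z₀
      A∩Z₀⊆ = subst (A ∩ Z₀ ⊆_) (sym (class-inside z₀∈Z₀)) (p∩q⊆q A Z₀)
    indec′ : x ∈ W → IndecOn f (class R′ x)
    indec′ {x} x∈W with x ∈? Z₀
    ... | yes x∈Z₀ = subst (IndecOn f) (sym (class-inside x∈Z₀)) indec₀
    ... | no x∉Z₀ = let x∈ = x∈p∧x∉q⇒x∈p─q x∈W x∉Z₀ in subst (IndecOn f) (sym (class-R′ x∈)) (indec x∈)

  partialIcDecomposition : ∀ W → PartialIcDecomposition W
  partialIcDecomposition W = build W (ℕ.<-wellFounded ∣ W ∣)
    where
    build : ∀ W → Acc ℕ._<_ ∣ W ∣ → PartialIcDecomposition W
    build W (acc smaller) with nonempty? W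
    ... | no empty = idRel , idRel-isEquiv , (λ x≡y x∈W → subst (_∈ W) (≟-true⁻ x≡y) x∈W) , sum
                   , λ x∈W → contradiction (_ , x∈W) empty
      where
      sum : ∀ A → A ⊆ W → f A ≡ restrictSum f idRel A
      sum A A⊆W rewrite Empty-unique {p = A} λ (x , x∈A) → empty (x , A⊆W x∈A) =
        trans f⊥ (sym (restrictSum-⊥ {f = f} f⊥ idRel))
    ... | yes nonempty-W with ⊆-minimal (λ Z → nonempty? Z ×-dec splits? f W Z) (nonempty-W , Splits-self f⊥)
    ...   | Z₀ , Z₀⊆W , (nonempty₀@(z₀ , z₀∈Z₀) , splits₀) , minimal =
      addClass Z₀⊆W nonempty₀ splits₀ (minimal-splits⇒IndecOn nonempty₀ splits₀ minimal)
        (build (W ─ Z₀) (smaller (p∩q≢∅⇒∣p─q∣<∣p∣ W Z₀ (z₀ , x∈p∩q⁺ (Z₀⊆W z₀∈Z₀ , z₀∈Z₀)))))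

icDecomposition : f ⊥ ≡ 0ℤ → Σ (Rel n) λ R → IsEquiv R × IsIcDecomp f R
icDecomposition f⊥ =
  let (R , eq , _ , sum , indec) = partialIcDecomposition f⊥ ⊤ in
  R , eq , (λ A → sum A ⊆⊤) , λ x → indec ∈⊤

-- The class E^W

ClassesIndec⇒EW : f ⊥ ≡ 0ℤ → IsEquiv R → ClassesIndec f R → EW f R
ClassesIndec⇒EW {f = f} {R = R} f⊥ eq indec = R , eq , (idempotent , indec′) , refl
  where
  idempotent : ∀ A → restrictSum f R A ≡ restrictSum (restrictSum f R) R A
  idempotent A = sumZ-cong λ x → cong (λ v → if isMin R x then v else 0ℤ)
                   (sym (restrictSum-class {f = f} f⊥ eq x (p∩q⊆q A (class R x))))
  indec′ : ClassesIndec (restrictSum f R) R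
  indec′ x = IndecOn-cong (λ _ A⊆ → restrictSum-class {f = f} f⊥ eq x A⊆) (indec x)

EW⇒ClassesIndec : f ⊥ ≡ 0ℤ → IsEquiv R → EW f R → ClassesIndec f R
EW⇒ClassesIndec {f = f} {R = R} f⊥ eqR (S , eqS , (_ , indecS) , clS≡clR) x =
  IndecOn-cong (λ _ A⊆ → sym (restrictSum-class {f = f} f⊥ eqR x A⊆))
               (subst (IndecOn (restrictSum f R)) class-S≡R (indecS x))
  where
  S⊆R : S ⊆R R
  S⊆R = ClassesIndec⇒⊆ (restrictSum-⊥ {f = f} f⊥ R) eqS eqR indecS
          λ x → restrictSum-Splits {f = f} f⊥ eqR (EquivRel.class-closed eqR x) λ _ → refl
  R⊆S : R ⊆R S
  R⊆S = cl-≡⇒⊇ eqR eqS S⊆R clS≡clR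
  class-S≡R : class S x ≡ class R x
  class-S≡R = ⊆-antisym (∈-class⁺ R ∘ S⊆R _ _ ∘ ∈-class⁻ S) (∈-class⁺ S ∘ R⊆S _ _ ∘ ∈-class⁻ R)

module Consequences {T : (n : ℕ) → BFun n → Set} {E : (n : ℕ) → BFun n → Rel n → Set} (H : Hyps T E) where
  open Hyps H

  E⇒ClassesIndec : T n f → E n f R → ClassesIndec f R
  E⇒ClassesIndec {n = n} {f = f} {R = R} Tf ER x =
    IndecOn-restrict⁻ ι f⊥ (Closed-covers (class-closed x) (∈-class-self x)) indec
    where
    f⊥ : f ⊥ ≡ 0ℤ
    f⊥ = T-empty Tf
    eq : IsEquiv R
    eq = E-equiv Tf ER
    open EquivRel eq
    X : Subset n
    X = class R x
    ι : Fin ∣ X ∣ → Fin n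
    ι = enum X
    u₀ : Fin ∣ X ∣
    u₀ = proj₁ (enum-onto X (∈-class-self x))
    Tι : T ∣ X ∣ (restrict ι f)
    Tι = T-restrict ι (enum-injective X) Tf
    Eι : E ∣ X ∣ (restrict ι f) (pullRel ι R)
    Eι = proj₁ (Equivalence.to (E-Δ ι (enum (∁ X)) (enum-split X) Tf R eq (Closed-NoCross eq (class-closed x))) ER)
    point : Fin ∣ X ∣ → Fin 1
    point _ = zero
    to-point : QuotRep (pullRel ι R) point
    to-point = (λ { zero → u₀ , refl ; (suc ()) }) , λ u v → mk⇔ (λ _ → class-related (enum-∈ X u) (enum-∈ X v)) (λ _ → refl)
    icι : IsIcDecomp (restrict ι f) (pullRel ι R)
    icι = Equivalence.to (E-ε-quot Tι (pullRel ι R) Eι point to-point)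
            (Modular-Fin1 {g = quot point (restrict ι f)}
              (trans (cong (restrict ι f) (preimage-⊥ point)) (restrict-⊥ {f = f} ι f⊥)))
    indec : IndecOn (restrict ι f) (preimage ι X)
    indec = subst (IndecOn (restrict ι f))
              (trans (class-pullRel {R = R} ι u₀) (cong (preimage ι ∘ class R) (proj₂ (enum-onto X (∈-class-self x)))))
              (proj₂ icι u₀)

  ClassesIndec⇒E : T n f → IsEquiv R → ClassesIndec f R → E n f R
  ClassesIndec⇒E {n = n} = go n (ℕ.<-wellFounded n)
    where
    go : ∀ n → Acc ℕ._<_ n → ∀ {f R} → T n f → IsEquiv R → ClassesIndec f R → E n f R
    go zero _ Tf _ _ = E-ext (λ _ → refl) (λ ()) Tf (E-ε-id Tf)
    go (suc n) (acc smaller) {f} {R} Tf eq indec =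
      Equivalence.from (E-Δ ι₁ ι₂ (enum-split X) Tf R eq (Closed-NoCross eq closed)) (E₁ , E₂)
      where
      open EquivRel eq
      f⊥ : f ⊥ ≡ 0ℤ
      f⊥ = T-empty Tf
      X : Subset (suc n)
      X = class R zero
      closed : Closed R X
      closed = class-closed zero
      ι₁ : Fin ∣ X ∣ → Fin (suc n)
      ι₁ = enum X
      ι₂ : Fin ∣ ∁ X ∣ → Fin (suc n)
      ι₂ = enum (∁ X)
      u₀ : Fin ∣ X ∣
      u₀ = proj₁ (enum-onto X (∈-class-self zero))
      E₁ : E ∣ X ∣ (restrict ι₁ f) (pullRel ι₁ R)
      E₁ = E-ε-ic (T-restrict ι₁ (enum-injective X) Tf) (pullRel ι₁ R) (pullRel-isEquiv ι₁ eq)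
             (IsIcDecomp-single (restrict-⊥ {f = f} ι₁ f⊥) (pullRel-isEquiv ι₁ eq)
               (λ v → class-related (enum-∈ X u₀) (enum-∈ X v)) (restrict-ClassesIndec f⊥ closed indec))
      ∣∁X∣<1+n : ∣ ∁ X ∣ ℕ.< suc n
      ∣∁X∣<1+n = subst (∣ ∁ X ∣ ℕ.<_) (∣⊤∣≡n (suc n))
                   (p⊂q⇒∣p∣<∣q∣ (⊆⊤ , zero , ∈⊤ , x∈p⇒x∉∁p (∈-class-self zero)))
      E₂ : E ∣ ∁ X ∣ (restrict ι₂ f) (pullRel ι₂ R)
      E₂ = go _ (smaller ∣∁X∣<1+n) (T-restrict ι₂ (enum-injective (∁ X)) Tf) (pullRel-isEquiv ι₂ eq)
             (restrict-ClassesIndec f⊥ (Closed-∁ eq closed) indec)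

  E⇒quotientIc : T n f → E n f R → ∀ k (π : Fin n → Fin k) → QuotRep R π
               → ∃ λ m → Ic f m × Ic (quot π f) m
  E⇒quotientIc {n = n} {f = f} {R = R} Tf ER k π quotRep =
    cl Rᵢ , (Rᵢ , eqᵢ , icᵢ , refl) , (R̄ , eqR̄ , icR̄ , trans (cl-quotient eqR̄ quotRepρ) (sym (cl-quotient eqᵢ quotRep∘)))
    where
    f⊥ : f ⊥ ≡ 0ℤ
    f⊥ = T-empty Tf
    eqR : IsEquiv R
    eqR = E-equiv Tf ER
    Rᵢ : Rel n
    Rᵢ = proj₁ (icDecomposition f⊥)
    eqᵢ : IsEquiv Rᵢ
    eqᵢ = proj₁ (proj₂ (icDecomposition f⊥))
    icᵢ : IsIcDecomp f Rᵢ
    icᵢ = proj₂ (proj₂ (icDecomposition f⊥))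
    Eᵢ : E n f Rᵢ
    Eᵢ = E-ε-ic Tf Rᵢ eqᵢ icᵢ
    R⊆Rᵢ : R ⊆R Rᵢ
    R⊆Rᵢ = ClassesIndec⇒⊆ f⊥ eqR eqᵢ (E⇒ClassesIndec Tf ER)
             λ x → restrictSum-Splits {f = f} f⊥ eqᵢ (EquivRel.class-closed eqᵢ x) (proj₁ icᵢ)
    R̄ : Rel k
    R̄ = barRel π Rᵢ
    ER̄ : E k (quot π f) R̄
    ER̄ = proj₂ (Equivalence.from (E-δ Tf R Rᵢ eqR eqᵢ R⊆Rᵢ π quotRep)
                  (Eᵢ , E-ext (proj₁ icᵢ) (λ _ _ → refl) Tf ER))
    Tq : T k (quot π f)
    Tq = T-quot π Tf ER quotRep
    eqR̄ : IsEquiv R̄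
    eqR̄ = E-equiv Tq ER̄
    ρ : Fin k → Fin (proj₁ (quotient eqR̄))
    ρ = proj₁ (proj₂ (quotient eqR̄))
    quotRepρ : QuotRep R̄ ρ
    quotRepρ = proj₂ (proj₂ (quotient eqR̄))
    quotRep∘ : QuotRep Rᵢ (ρ ∘ π)
    quotRep∘ = QuotRep-∘ quotRep eqᵢ R⊆Rᵢ quotRepρ
    icR̄ : IsIcDecomp (quot π f) R̄
    icR̄ = Equivalence.to (E-ε-quot Tq R̄ ER̄ ρ quotRepρ)
            (Modular-cong (λ A → cong f (sym (preimage-∘ π ρ A)))
              (Equivalence.from (E-ε-quot Tf Rᵢ Eᵢ (ρ ∘ π) quotRep∘) icᵢ))

proposition3p19 : (T : (n : ℕ) → BFun n → Set) (E : (n : ℕ) → BFun n → Rel n → Set)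
    → Hyps T E
    → ∀ n (f : BFun n) → T n f → (R : Rel n) → IsEquiv R
    → (E n f R ⇔ ES f R) × (ES f R ⇔ EW f R)
proposition3p19 T E H n f Tf R eqR = mk⇔ E⇒ES (E⇐EW ∘ proj₁) , mk⇔ proj₁ (E⇒ES ∘ E⇐EW)
  where
  open Consequences H
  f⊥ : f ⊥ ≡ 0ℤ
  f⊥ = Hyps.T-empty H Tf
  E⇐EW : EW f R → E n f R
  E⇐EW = ClassesIndec⇒E Tf eqR ∘ EW⇒ClassesIndec f⊥ eqR
  E⇒ES : E n f R → ES f R
  E⇒ES ER = ClassesIndec⇒EW f⊥ eqR (E⇒ClassesIndec Tf ER) , E⇒quotientIc Tf ER
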